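{- Let $G$ be a cactus (a connected graph in which no edge lies in more than one cycle) containing at least two cycles. Then $G$ has a barbell partition, and thus $G\notin G^{SSP}$.
   Context: All graphs are finite and simple. A barbell partition of a graph $G$ is a partition of $V(G)$ into three disjoint sets $\{R,W_1,W_2\}$ such that: $R$ may be empty but $W_1\neq\emptyset$ and $W_2\neq\emptyset$; there are no edges between vertices of $W_1$ and vertices of $W_2$; and for every $v\in R$ and $i\in\{1,2\}$, $|N_G(v)\cap W_i|\neq 1$. For $G$ on vertex set $\{1,\dots,n\}$, $\mathcal S(G)$ is the set of real symmetric matrices whose $(i,j)$ entry ($i\ne j$) is nonzero iff $ij\in E(G)$. A real symmetric $A$ has the Strong Spectral Property (SSP) if the only real symmetric $X$ with $A\circ X=O$ (entrywise product), $I\circ X=O$ and $AX=XA$ is $X=O$. $G^{SSP}$ is the class of graphs $G$ such that every $A\in\mathcal S(G)$ has the SSP. -}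

module Defs where

open import Level using (0ℓ)
open import Data.Nat using (ℕ; zero; suc)
open import Data.Fin using (Fin; zero; suc; _≟_)
open import Data.Fin.Properties using ()
open import Data.Bool using (Bool; true; false; if_then_else_; _∧_)
open import Data.List using (List; map; allFin)
open import Data.Nat.ListAction using (sum)
open import Data.Product using (Σ; ∃; _×_; _,_)
open import Data.Sum using (_⊎_)
open import Relation.Nullary using (¬_; does)
open import Relation.Binary.PropositionalEquality using (_≡_; _≢_)
open import Algebra.Bundles using (CommutativeRing)

-- Finite simple graphs on vertex set Fin n (vertices 1..n of the paper)

record Graph (n : ℕ) : Set where
  field
    adj     : Fin n → Fin n → Bool
    adj-sym : ∀ u v → adj u v ≡ adj v u
    irrefl  : ∀ v → adj v v ≡ false

open Graph public

Edge : ∀ {n} → Graph n → Fin n → Fin n → Set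
Edge G u v = adj G u v ≡ true

data Walk {n} (G : Graph n) : Fin n → Fin n → Set where
  here : ∀ {v} → Walk G v v
  step : ∀ {u v w} → Edge G u v → Walk G v w → Walk G u w

Connected : ∀ {n} → Graph n → Set
Connected G = ∀ u v → Walk G u v

-- cyclic successor on Fin (suc m): i ↦ i+1 mod (suc m)
next : ∀ {m} → Fin (suc m) → Fin (suc m)
next {zero} zero = zero
next {suc m} zero = suc zero
next {suc m} (suc i) with next {m} i
... | zero = zero
... | suc j = suc (suc j)

record Cycle {n} (G : Graph n) : Set where
  field
    len₋₃    : ℕ
    vert     : Fin (suc (suc (suc len₋₃))) → Fin n
    injective : ∀ i j → vert i ≡ vert j → i ≡ j
    edges    : ∀ i → Edge G (vert i) (vert (next i))

open Cycle public

CycleEdge : ∀ {n} {G : Graph n} → Cycle G → Fin n → Fin n → Set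
CycleEdge C u v =
  ∃ λ i → (vert C i ≡ u × vert C (next i) ≡ v) ⊎ (vert C i ≡ v × vert C (next i) ≡ u)

-- two cycles are the same cycle (as subgraphs) iff they have the same edges
SameCycle : ∀ {n} {G : Graph n} → Cycle G → Cycle G → Set
SameCycle C D = ∀ u v → (CycleEdge C u v → CycleEdge D u v) × (CycleEdge D u v → CycleEdge C u v)

IsCactus : ∀ {n} → Graph n → Set
IsCactus G = Connected G ×
  (∀ (C D : Cycle G) u v → CycleEdge C u v → CycleEdge D u v → SameCycle C D)

AtLeastTwoCycles : ∀ {n} → Graph n → Set
AtLeastTwoCycles G = Σ (Cycle G) λ C → Σ (Cycle G) λ D → ¬ SameCycle C D

data Part : Set where
  R W₁ W₂ : Part

isPart : Part → Part → Bool
isPart R R = true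
isPart W₁ W₁ = true
isPart W₂ W₂ = true
isPart _ _ = false

nbrCount : ∀ {n} → Graph n → (Fin n → Part) → Fin n → Part → ℕ
nbrCount {n} G part v p =
  sum (map (λ u → if adj G v u ∧ isPart p (part u) then 1 else 0) (allFin n))

record BarbellPartition {n} (G : Graph n) : Set where
  field
    part      : Fin n → Part
    W₁-nonempty : ∃ λ v → part v ≡ W₁
    W₂-nonempty : ∃ λ v → part v ≡ W₂
    no-W₁W₂-edge : ∀ u v → part u ≡ W₁ → part v ≡ W₂ → ¬ Edge G u v
    R-condition : ∀ v → part v ≡ R → nbrCount G part v W₁ ≢ 1 × nbrCount G part v W₂ ≢ 1

-- The real numbers, abstractly: a Dedekind-complete ordered field
-- (unique up to isomorphism, so this is a faithful stand-in for ℝ)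

record RealField : Set₁ where
  field
    cring : CommutativeRing 0ℓ 0ℓ
  open CommutativeRing cring public using (Carrier; _≈_; _+_; _*_; 0#; 1#)
  field
    _≤_        : Carrier → Carrier → Set
    ≤-resp-≈   : ∀ {x x' y y'} → x ≈ x' → y ≈ y' → x ≤ y → x' ≤ y'
    ≤-refl     : ∀ {x} → x ≤ x
    ≤-trans    : ∀ {x y z} → x ≤ y → y ≤ z → x ≤ z
    ≤-antisym  : ∀ {x y} → x ≤ y → y ≤ x → x ≈ y
    ≤-total    : ∀ x y → x ≤ y ⊎ y ≤ x
    +-mono-≤   : ∀ {x y} z → x ≤ y → (x + z) ≤ (y + z)
    *-nonneg   : ∀ {x y} → 0# ≤ x → 0# ≤ y → 0# ≤ (x * y)
    0≉1        : ¬ (0# ≈ 1#)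
    inverse    : ∀ x → ¬ (x ≈ 0#) → ∃ λ y → (x * y) ≈ 1#
    complete   : (P : Carrier → Set) → (∃ P) → (∃ λ b → ∀ x → P x → x ≤ b) →
                 ∃ λ s → (∀ x → P x → x ≤ s) × (∀ b → (∀ x → P x → x ≤ b) → s ≤ b)

module _ (ℝ : RealField) where
  open RealField ℝ using (Carrier; _≈_; _+_; _*_; 0#; 1#)

  Matrix : ℕ → Set
  Matrix n = Fin n → Fin n → Carrier

  sumF : ∀ {n} → (Fin n → Carrier) → Carrier
  sumF {zero} f = 0#
  sumF {suc n} f = f zero + sumF (λ i → f (suc i))

  _⊗_ : ∀ {n} → Matrix n → Matrix n → Matrix n
  (A ⊗ B) i j = sumF (λ k → A i k * B k j)

  _∘ₕ_ : ∀ {n} → Matrix n → Matrix n → Matrix n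
  (A ∘ₕ B) i j = A i j * B i j

  idM : ∀ {n} → Matrix n
  idM i j = if does (i ≟ j) then 1# else 0#

  IsZeroM : ∀ {n} → Matrix n → Set
  IsZeroM A = ∀ i j → A i j ≈ 0#

  Symmetric : ∀ {n} → Matrix n → Set
  Symmetric A = ∀ i j → A i j ≈ A j i

  InS : ∀ {n} → Graph n → Matrix n → Set
  InS G A = Symmetric A ×
    (∀ i j → i ≢ j → (¬ (A i j ≈ 0#) → Edge G i j) × (Edge G i j → ¬ (A i j ≈ 0#)))

  HasSSP : ∀ {n} → Matrix n → Set
  HasSSP A = ∀ X → Symmetric X → IsZeroM (A ∘ₕ X) → IsZeroM (idM ∘ₕ X) →
    (∀ i j → (A ⊗ X) i j ≈ (X ⊗ A) i j) → IsZeroM X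

  InGSSP : ∀ {n} → Graph n → Set
  InGSSP G = ∀ A → InS G A → HasSSP A

module Submission where

open import Defs
open import Data.Nat using (ℕ)
open import Data.Product using (_×_; _,_)
open import Relation.Nullary using (¬_)

-- Let C ≠ D be cycles and P a walk from v ∈ C to w ∈ D meeting C only in v and D only in w.
-- Put into W₁ the vertices reachable from C by walks avoiding v, into W₂ those reachable from
-- D by walks avoiding w, and the rest into R. As no edge lies on two cycles, a path leaving a
-- cycle along a non-cycle edge cannot return to it at another vertex: closing it up with an arc
-- of the cycle would give a second cycle through an edge of the first. Hence two cycles share at
-- most one vertex and v separates the far side of P from C, which makes W₁ and W₂ disjoint and
-- non-adjacent. A vertex of R has no neighbour in W₁ unless it is v, which has two (on C);
-- likewise for W₂ and w.
--
-- For the SSP, weight the edges from each vertex r ∈ R to W₁ so that they sum to zero (possible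
-- as r does not have exactly one neighbour there), likewise for W₂, and choose the diagonal so
-- that A kills the indicator vectors u, v of W₁, W₂. Then X = u vᵀ + v uᵀ is nonzero, symmetric,
-- supported on W₁ × W₂ ∪ W₂ × W₁ (no edges, no diagonal), and A X = X A = O.

module Lists where

  open import Data.Nat using (_≤_)
  open import Data.Nat.Properties using (_≤?_; ≰⇒>; <-irrefl)
  open import Data.Fin using (Fin; zero; suc)
  open import Data.Fin.Properties using (pigeonhole)
  open import Data.List using (List; []; _∷_; _++_; [_]; length; lookup)
  open import Data.List.Properties using (++-assoc; ∷-injectiveˡ)
  open import Data.List.Membership.Propositional using (_∈_; _∉_)
  open import Data.List.Relation.Binary.Subset.Propositional using (_⊆_)
  open import Data.List.Membership.Propositional.Properties using (∈-++⁺ˡ; ∈-++⁺ʳ; ∈-++⁻; ∈-∃++; ∈-lookup)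
  open import Data.List.Relation.Unary.All.Properties using (¬Any⇒All¬; All¬⇒¬Any)
  import Data.List.Relation.Unary.All.Properties as All
  open import Data.List.Relation.Unary.Any using (here; there)
  open import Data.List.Relation.Unary.AllPairs using ([]; _∷_)
  import Data.List.Relation.Unary.AllPairs as AllPairs
  open import Data.List.Relation.Unary.Unique.Propositional using (Unique)
  import Data.List.Relation.Unary.Unique.Propositional.Properties as Unique
  open import Data.List.Relation.Unary.Linked using (Linked; []; [-]; _∷_)
  import Data.List.Relation.Unary.Linked as Linked
  open import Data.Product using (∃; ∃₂; _×_; _,_)
  open import Data.Sum using (_⊎_; inj₁; inj₂)
  open import Relation.Nullary using (¬_; Dec; yes; no; contradiction)
  open import Relation.Binary.PropositionalEquality using (_≡_; _≢_; refl; sym; cong; subst)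

  module _ {A : Set} where

    unique-∷ : ∀ {x : A} {xs} → x ∉ xs → Unique xs → Unique (x ∷ xs)
    unique-∷ {xs = xs} x∉xs xs! = ¬Any⇒All¬ xs x∉xs ∷ xs!

    unique-++ : ∀ {xs ys : List A} → Unique xs → Unique ys → (∀ {z} → z ∈ xs → z ∉ ys) → Unique (xs ++ ys)
    unique-++ xs! ys! disjoint = Unique.++⁺ xs! ys! λ (z∈xs , z∈ys) → disjoint z∈xs z∈ys

    unique-++⁻ˡ : ∀ (xs : List A) {ys} → Unique (xs ++ ys) → Unique xs
    unique-++⁻ˡ []       _           = []
    unique-++⁻ˡ (x ∷ xs) (x# ∷ xys!) = All.++⁻ˡ xs x# ∷ unique-++⁻ˡ xs xys!

    unique-++⁻ʳ : ∀ (xs : List A) {ys} → Unique (xs ++ ys) → Unique ys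
    unique-++⁻ʳ []       xys!       = xys!
    unique-++⁻ʳ (x ∷ xs) (_ ∷ xys!) = unique-++⁻ʳ xs xys!

    unique-++-disjoint : ∀ (xs : List A) {ys z} → Unique (xs ++ ys) → z ∈ xs → z ∉ ys
    unique-++-disjoint (x ∷ xs) (x# ∷ _)    (here refl) z∈ys = All¬⇒¬Any (All.++⁻ʳ xs x#) z∈ys
    unique-++-disjoint (x ∷ xs) (_ ∷ xys!) (there z∈xs) = unique-++-disjoint xs xys! z∈xs

    lookup-injective : ∀ {xs : List A} → Unique xs → ∀ i j → lookup xs i ≡ lookup xs j → i ≡ j
    lookup-injective {x ∷ xs} _         zero    zero    _  = refl
    lookup-injective {x ∷ xs} (x# ∷ _)  zero    (suc j) eq = contradiction (subst (_∈ xs) (sym eq) (∈-lookup j)) (All¬⇒¬Any x#)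
    lookup-injective {x ∷ xs} (x# ∷ _)  (suc i) zero    eq = contradiction (subst (_∈ xs) eq (∈-lookup i)) (All¬⇒¬Any x#)
    lookup-injective {x ∷ xs} (_ ∷ xs!) (suc i) (suc j) eq = cong suc (lookup-injective xs! i j eq)

    both-[]? : ∀ (xs ys : List A) → Dec (xs ≡ [] × ys ≡ [])
    both-[]? []      []      = yes (refl , refl)
    both-[]? []      (_ ∷ _) = no λ { (_ , ()) }
    both-[]? (_ ∷ _) _       = no λ { (() , _) }

    ++-∷-atLeastTwo : ∀ (ps : List A) t qs → ¬ (ps ≡ [] × qs ≡ []) → ∃₂ λ z₁ z₂ → ∃ λ zs → ps ++ t ∷ qs ≡ z₁ ∷ z₂ ∷ zs
    ++-∷-atLeastTwo []            t []       ¬empty = contradiction (refl , refl) ¬empty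
    ++-∷-atLeastTwo []            t (q ∷ qs) _      = t , q , qs , refl
    ++-∷-atLeastTwo (p ∷ [])      t qs       _      = p , t , qs , refl
    ++-∷-atLeastTwo (p ∷ p′ ∷ ps) t qs       _      = p , p′ , ps ++ t ∷ qs , refl

    head⁺ : List A → A → A
    head⁺ []      y = y
    head⁺ (x ∷ _) _ = x

    head⁺-∷ʳ : ∀ {x : A} {xs} ws {y} → x ∷ xs ≡ ws ++ [ y ] → head⁺ ws y ≡ x
    head⁺-∷ʳ []      eq = sym (∷-injectiveˡ eq)
    head⁺-∷ʳ (_ ∷ _) eq = sym (∷-injectiveˡ eq)

    last⁺ : A → List A → A
    last⁺ y []       = y
    last⁺ _ (x ∷ xs) = last⁺ x xs

  unique-length≤ : ∀ {n} {xs : List (Fin n)} → Unique xs → length xs ≤ n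
  unique-length≤ {n} {xs} xs! with length xs ≤? n
  ... | yes xs≤n = xs≤n
  ... | no xs≰n with pigeonhole (≰⇒> xs≰n) (lookup xs)
  ...   | i , j , i<j , eq with lookup-injective xs! i j eq
  ...     | refl = contradiction i<j (<-irrefl refl)

  module _ {A : Set} {R : A → A → Set} where

    linked-++⁻ˡ : ∀ (xs : List A) {ys} → Linked R (xs ++ ys) → Linked R xs
    linked-++⁻ˡ []           _         = []
    linked-++⁻ˡ (x ∷ [])     _         = [-]
    linked-++⁻ˡ (x ∷ y ∷ xs) (r ∷ rs) = r ∷ linked-++⁻ˡ (y ∷ xs) rs

    linked-++⁻ʳ : ∀ (xs : List A) {ys} → Linked R (xs ++ ys) → Linked R ys
    linked-++⁻ʳ []           rs = rs
    linked-++⁻ʳ (x ∷ xs)     rs = linked-++⁻ʳ xs (Linked.tail rs)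

    linked-join : ∀ (xs : List A) {y ys} → Linked R (xs ++ [ y ]) → Linked R (y ∷ ys) → Linked R (xs ++ y ∷ ys)
    linked-join []           _        rs′ = rs′
    linked-join (x ∷ [])     (r ∷ _)  rs′ = r ∷ rs′
    linked-join (x ∷ y ∷ xs) (r ∷ rs) rs′ = r ∷ linked-join (y ∷ xs) rs rs′

    linked-first : ∀ {x} ys {y zs} → Linked R (x ∷ ys ++ y ∷ zs) → R x (head⁺ ys y)
    linked-first []      rs = Linked.head rs
    linked-first (_ ∷ _) rs = Linked.head rs

    linked-last : ∀ (xs : List A) {y ys z} → Linked R (xs ++ y ∷ ys ++ [ z ]) → R (last⁺ y ys) z
    linked-last []       {ys = []}     rs = Linked.head rs
    linked-last []       {ys = _ ∷ ys} rs = linked-last [] {ys = ys} (Linked.tail rs)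
    linked-last (_ ∷ xs) rs = linked-last xs (Linked.tail rs)

    arc : ∀ ys {p} mid {q} zs → Unique (ys ++ p ∷ mid ++ q ∷ zs) → Linked R (ys ++ p ∷ mid ++ q ∷ zs) →
      Linked R (p ∷ mid ++ [ q ]) × p ∉ mid × q ∉ mid × Unique mid
    arc ys {p} mid {q} zs xs! rs =
      linked-++⁻ˡ (p ∷ mid ++ [ q ]) (subst (Linked R) (sym (++-assoc (p ∷ mid) [ q ] zs)) (linked-++⁻ʳ ys rs)) ,
      (λ p∈mid → All¬⇒¬Any (AllPairs.head p∷mid∷q∷zs!) (∈-++⁺ˡ p∈mid)) ,
      (λ q∈mid → unique-++-disjoint mid mid∷q∷zs! q∈mid (here refl)) ,
      unique-++⁻ˡ mid mid∷q∷zs!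
      where
      p∷mid∷q∷zs! : Unique (p ∷ mid ++ q ∷ zs)
      p∷mid∷q∷zs! = unique-++⁻ʳ ys xs!
      mid∷q∷zs! : Unique (mid ++ q ∷ zs)
      mid∷q∷zs! = AllPairs.tail p∷mid∷q∷zs!

    segment : ∀ {xs : List A} {p q} → Unique xs → Linked R xs → p ∈ xs → q ∈ xs → p ≢ q →
      ∃ λ mid → (Linked R (p ∷ mid ++ [ q ]) ⊎ Linked R (q ∷ mid ++ [ p ])) × mid ⊆ xs × p ∉ mid × q ∉ mid × Unique mid
    segment {xs} {p} {q} xs! rs p∈xs q∈xs p≢q with ∈-∃++ p∈xs
    ... | ys , zs , refl with ∈-++⁻ ys q∈xs
    ...   | inj₂ (here q≡p) = contradiction (sym q≡p) p≢q
    ...   | inj₂ (there q∈zs) with ∈-∃++ q∈zs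
    ...     | mid , zs′ , refl with arc ys mid zs′ xs! rs
    ...       | p⋯q , p∉mid , q∉mid , mid! = mid , inj₁ p⋯q , (λ z∈mid → ∈-++⁺ʳ ys (there (∈-++⁺ˡ z∈mid))) , p∉mid , q∉mid , mid!
    segment {xs} {p} {q} xs! rs p∈xs q∈xs p≢q | ys , zs , refl | inj₁ q∈ys with ∈-∃++ q∈ys
    ... | ys′ , mid , refl with arc ys′ mid zs (subst Unique assoc xs!) (subst (Linked R) assoc rs)
      where
      assoc : (ys′ ++ q ∷ mid) ++ p ∷ zs ≡ ys′ ++ q ∷ mid ++ p ∷ zs
      assoc = ++-assoc ys′ (q ∷ mid) (p ∷ zs)
    ...   | q⋯p , q∉mid , p∉mid , mid! = mid , inj₂ q⋯p , (λ z∈mid → ∈-++⁺ˡ (∈-++⁺ʳ ys′ (there z∈mid))) , p∉mid , q∉mid , mid!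

module Walks where

  open Lists
  open import Level using (0ℓ)
  open import Data.Nat using (ℕ; suc)
  open import Data.Fin using (Fin)
  open import Data.Fin.Properties using (_≟_)
  open import Data.List using (List; []; _∷_; _++_; [_]; length)
  open import Data.List.Membership.Propositional using (_∈_)
  open import Data.List.Relation.Binary.Subset.Propositional using (_⊆_)
  open import Data.List.Relation.Unary.Any using (here; there)
  open import Data.List.Relation.Unary.Linked using (Linked; [-]; _∷_)
  open import Data.List.Relation.Unary.Unique.Propositional using (Unique)
  open import Data.List.Relation.Unary.AllPairs using ([]; _∷_)
  open import Data.Product using (Σ; ∃; _×_; _,_)
  open import Data.Sum using (_⊎_; inj₁; inj₂)
  open import Relation.Nullary using (¬_; yes; no; contradiction)
  open import Relation.Unary using (Pred; Decidable)
  open import Relation.Binary.PropositionalEquality using (_≡_; _≢_; refl; sym; trans; cong)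

  module _ {n} (G : Graph n) where

    edge-sym : ∀ {u v} → Edge G u v → Edge G v u
    edge-sym {u} {v} e = trans (adj-sym G v u) e

    edge-irrefl : ∀ {u v} → Edge G u v → u ≢ v
    edge-irrefl {u} e refl with trans (sym e) (irrefl G u)
    ... | ()

  module _ {n} {G : Graph n} where

    open import Data.List.Membership.DecPropositional (_≟_ {n}) using (_∈?_)

    verts : ∀ {u w} → Walk G u w → List (Fin n)
    verts {u} here       = u ∷ []
    verts {u} (step _ p) = u ∷ verts p

    inner : ∀ {u w} → Walk G u w → List (Fin n)
    inner here       = []
    inner (step _ p) = verts p

    lengthʷ : ∀ {u w} → Walk G u w → ℕ
    lengthʷ here       = 0
    lengthʷ (step _ p) = suc (lengthʷ p)

    length-verts : ∀ {u w} (p : Walk G u w) → length (verts p) ≡ suc (lengthʷ p)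
    length-verts here       = refl
    length-verts (step _ p) = cong suc (length-verts p)

    verts≡∷inner : ∀ {u w} (p : Walk G u w) → verts p ≡ u ∷ inner p
    verts≡∷inner here       = refl
    verts≡∷inner (step _ p) = refl

    start-∈ : ∀ {u w} (p : Walk G u w) → u ∈ verts p
    start-∈ here       = here refl
    start-∈ (step _ p) = here refl

    end-∈ : ∀ {u w} (p : Walk G u w) → w ∈ verts p
    end-∈ here       = here refl
    end-∈ (step _ p) = there (end-∈ p)

    _++ʷ_ : ∀ {u v w} → Walk G u v → Walk G v w → Walk G u w
    here     ++ʷ q = q
    step e p ++ʷ q = step e (p ++ʷ q)

    ∈-++ʷ⁻ : ∀ {u v w} (p : Walk G u v) (q : Walk G v w) {z} → z ∈ verts (p ++ʷ q) → z ∈ verts p ⊎ z ∈ verts q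
    ∈-++ʷ⁻ here       q z∈q           = inj₂ z∈q
    ∈-++ʷ⁻ (step e p) q (here refl)   = inj₁ (here refl)
    ∈-++ʷ⁻ (step e p) q (there z∈pq) with ∈-++ʷ⁻ p q z∈pq
    ... | inj₁ z∈p = inj₁ (there z∈p)
    ... | inj₂ z∈q = inj₂ z∈q

    reverseʷ : ∀ {u w} → Walk G u w → Walk G w u
    reverseʷ here       = here
    reverseʷ (step e p) = reverseʷ p ++ʷ step (edge-sym G e) here

    ∈-reverseʷ⁻ : ∀ {u w} (p : Walk G u w) {z} → z ∈ verts (reverseʷ p) → z ∈ verts p
    ∈-reverseʷ⁻ here       z∈p = z∈p
    ∈-reverseʷ⁻ (step e p) z∈p with ∈-++ʷ⁻ (reverseʷ p) _ z∈p
    ... | inj₁ z∈p′             = there (∈-reverseʷ⁻ p z∈p′)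
    ... | inj₂ (here refl)      = there (start-∈ p)
    ... | inj₂ (there (here refl)) = here refl

    verts-linked : ∀ {u w} (p : Walk G u w) → Linked (Edge G) (verts p)
    verts-linked here                = [-]
    verts-linked (step e here)       = e ∷ [-]
    verts-linked (step e (step e′ p)) = e ∷ verts-linked (step e′ p)

    verts≡∷ʳ : ∀ {u w} (p : Walk G u w) → ∃ λ ws → verts p ≡ ws ++ [ w ]
    verts≡∷ʳ here = [] , refl
    verts≡∷ʳ {u} (step e p) with verts≡∷ʳ p
    ... | ws , eq = u ∷ ws , cong (u ∷_) eq

    last⁺-inner : ∀ {u w} (p : Walk G u w) → last⁺ u (inner p) ≡ w
    last⁺-inner here       = refl
    last⁺-inner (step e p) rewrite verts≡∷inner p = last⁺-inner p

    verts-linked-∷ʳ : ∀ {u w z} (p : Walk G u w) → Edge G w z → Linked (Edge G) (verts p ++ [ z ])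
    verts-linked-∷ʳ here       e′ = e′ ∷ [-]
    verts-linked-∷ʳ (step e p) e′ with verts p | verts≡∷inner p | verts-linked-∷ʳ p e′
    ... | _ | refl | es = e ∷ es

    fromLinked : ∀ ys c → Linked (Edge G) (ys ++ [ c ]) → Σ (Walk G (head⁺ ys c) c) λ p → verts p ≡ ys ++ [ c ]
    fromLinked []           c _        = here , refl
    fromLinked (y ∷ [])     c (e ∷ _)  = step e here , refl
    fromLinked (y ∷ y′ ∷ ys) c (e ∷ es) with fromLinked (y′ ∷ ys) c es
    ... | p , eq = step e p , cong (y ∷_) eq

    suffixFrom : ∀ {x w v} (p : Walk G x w) → v ∈ verts p →
      Σ (Walk G v w) λ q → verts q ⊆ verts p × (Unique (verts p) → Unique (verts q))
    suffixFrom here       (here refl)  = here , (λ z∈ → z∈) , (λ p! → p!)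
    suffixFrom (step e p) (here refl)  = step e p , (λ z∈ → z∈) , (λ p! → p!)
    suffixFrom (step e p) (there v∈p) with suffixFrom p v∈p
    ... | q , q⊆p , q! = q , (λ z∈q → there (q⊆p z∈q)) , λ { (_ ∷ p!) → q! p! }

    prefixTo : ∀ {x w v} (p : Walk G x w) → v ∈ verts p → Σ (Walk G x v) λ q → verts q ⊆ verts p
    prefixTo here       (here refl)  = here , λ z∈ → z∈
    prefixTo (step e p) (here refl)  = here , λ { (here refl) → here refl }
    prefixTo (step e p) (there v∈p) with prefixTo p v∈p
    ... | q , q⊆p = step e q , λ { (here refl) → here refl ; (there z∈q) → there (q⊆p z∈q) }

    toPath : ∀ {u w} (p : Walk G u w) → Σ (Walk G u w) λ q → Unique (verts q) × verts q ⊆ verts p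
    toPath here = here , unique-∷ (λ ()) [] , λ z∈ → z∈
    toPath {u} (step e p) with toPath p
    ... | q , q! , q⊆p with u ∈? verts q
    ...   | yes u∈q = let (r , r⊆q , r!) = suffixFrom q u∈q in r , r! q! , λ z∈r → there (q⊆p (r⊆q z∈r))
    ...   | no u∉q  = step e q , unique-∷ u∉q q! , λ { (here refl) → here refl ; (there z∈q) → there (q⊆p z∈q) }

    module _ (P : Pred (Fin n) 0ℓ) (P? : Decidable P) where

      firstVisit : ∀ {a b} (S : Walk G a b) → P b →
        ∃ λ c → P c × Σ (Walk G a c) λ T → (∀ {z} → z ∈ verts T → P z → z ≡ c) × verts T ⊆ verts S
      firstVisit {a} S Pb with P? a
      ... | yes Pa = a , Pa , here , (λ { (here refl) _ → refl }) , λ { (here refl) → start-∈ S }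
      firstVisit here       Pb | no ¬Pa = contradiction Pb ¬Pa
      firstVisit (step e S) Pb | no ¬Pa with firstVisit S Pb
      ... | c , Pc , T , T∩P⊆c , T⊆S =
        c , Pc , step e T , (λ { (here refl) Pz → contradiction Pz ¬Pa ; (there z∈T) → T∩P⊆c z∈T }) ,
        λ { (here refl) → here refl ; (there z∈T) → there (T⊆S z∈T) }

      LastVisit : ∀ {a b} → Walk G a b → Set
      LastVisit {b = b} S = ∃ λ c → P c × Σ (Walk G c b) λ T → (∀ {z} → z ∈ inner T → ¬ P z) × verts T ⊆ verts S

      avoids-or-lastVisit : ∀ {a b} (S : Walk G a b) → (∀ {z} → z ∈ verts S → ¬ P z) ⊎ LastVisit S
      avoids-or-lastVisit {a} (step e S) with avoids-or-lastVisit S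
      ... | inj₂ (c , Pc , T , T∌P , T⊆S) = inj₂ (c , Pc , T , T∌P , λ z∈T → there (T⊆S z∈T))
      ... | inj₁ S∌P with P? a
      ...   | yes Pa = inj₂ (a , Pa , step e S , S∌P , λ z∈ → z∈)
      ...   | no ¬Pa = inj₁ λ { (here refl) → ¬Pa ; (there z∈S) → S∌P z∈S }
      avoids-or-lastVisit {a} here with P? a
      ... | yes Pa = inj₂ (a , Pa , here , (λ ()) , λ z∈ → z∈)
      ... | no ¬Pa = inj₁ λ { (here refl) → ¬Pa }

      lastVisit : ∀ {a b} (S : Walk G a b) → P a → LastVisit S
      lastVisit S Pa with avoids-or-lastVisit S
      ... | inj₁ S∌P  = contradiction Pa (S∌P (start-∈ S))
      ... | inj₂ last = last

module Cycles where

  open Lists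
  open Walks
  open import Data.Nat using (ℕ; zero; suc)
  import Data.Nat.Properties as ℕ
  open import Data.Fin using (Fin; zero; suc; inject₁; fromℕ; toℕ)
  open import Data.Fin.Properties using (_≟_; toℕ-inject₁)
  open import Data.List using (List; []; _∷_; _++_; [_]; length; lookup; tabulate)
  open import Data.List.Membership.Propositional using (_∈_)
  open import Data.List.Membership.Propositional.Properties using (∈-tabulate⁻; ∈-tabulate⁺)
  open import Data.List.Relation.Unary.Linked using (Linked; [-]; _∷_)
  open import Data.List.Relation.Unary.Unique.Propositional using (Unique)
  import Data.List.Relation.Unary.Unique.Propositional.Properties as Unique
  open import Data.Product using (Σ; ∃; ∃₂; _×_; _,_)
  open import Data.Sum using (_⊎_; inj₁; inj₂)
  open import Relation.Unary using (Decidable)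
  open import Relation.Binary.PropositionalEquality using (_≡_; _≢_; refl; sym; trans; cong; subst; module ≡-Reasoning)

  next-inject₁ : ∀ {m} (i : Fin m) → next (inject₁ i) ≡ suc i
  next-inject₁ {suc m} zero = refl
  next-inject₁ {suc m} (suc i) rewrite next-inject₁ i = refl

  next-fromℕ : ∀ m → next (fromℕ m) ≡ zero
  next-fromℕ zero = refl
  next-fromℕ (suc m) rewrite next-fromℕ m = refl

  fromℕ-or-inject₁ : ∀ {m} (j : Fin (suc m)) → j ≡ fromℕ m ⊎ ∃ λ k → j ≡ inject₁ k
  fromℕ-or-inject₁ {zero} zero = inj₁ refl
  fromℕ-or-inject₁ {suc m} zero = inj₂ (zero , refl)
  fromℕ-or-inject₁ {suc m} (suc j) with fromℕ-or-inject₁ j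
  ... | inj₁ e = inj₁ (cong suc e)
  ... | inj₂ (k , e) = inj₂ (suc k , cong suc e)

  prev : ∀ {m} → Fin (suc m) → Fin (suc m)
  prev zero    = fromℕ _
  prev (suc k) = inject₁ k

  next-prev : ∀ {m} (j : Fin (suc m)) → next (prev j) ≡ j
  next-prev zero    = next-fromℕ _
  next-prev (suc k) = next-inject₁ k

  next≢prev : ∀ {m} (j : Fin (suc (suc (suc m)))) → next j ≢ prev j
  next≢prev zero ()
  next≢prev {m} (suc k) eq with fromℕ-or-inject₁ k
  ... | inj₁ refl rewrite next-fromℕ (suc (suc m)) with eq
  ...   | ()
  next≢prev {m} (suc k) eq | inj₂ (k′ , refl) = ℕ.m≢1+n+m (toℕ k′) {1} (sym (begin
    suc (suc (toℕ k′))           ≡⟨ cong toℕ (trans (sym (next-inject₁ (suc k′))) eq) ⟩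
    toℕ (inject₁ (inject₁ k′))   ≡⟨ toℕ-inject₁ (inject₁ k′) ⟩
    toℕ (inject₁ k′)             ≡⟨ toℕ-inject₁ k′ ⟩
    toℕ k′                       ∎))
    where open ≡-Reasoning

  module _ {A : Set} where

    lookup-next-suc : ∀ (t y : A) ys (i : Fin (suc (length ys))) →
      lookup (t ∷ y ∷ ys) (next (suc i)) ≡ lookup (t ∷ ys) (next i)
    lookup-next-suc t y ys i with next {length ys} i
    ... | zero  = refl
    ... | suc j = refl

    -- For t = x, lookup (t ∷ xs) ∘ next is the cyclic successor in x ∷ xs; the closing
    -- entry t is kept apart from x for the induction.
    module _ {R : A → A → Set} where

      linked⇒R-next : ∀ t x xs → Linked R (x ∷ xs ++ [ t ]) → ∀ i → R (lookup (x ∷ xs) i) (lookup (t ∷ xs) (next i))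
      linked⇒R-next t x []       (r ∷ _)  zero    = r
      linked⇒R-next t x (y ∷ ys) (r ∷ _)  zero    = r
      linked⇒R-next t x (y ∷ ys) (_ ∷ rs) (suc i) rewrite lookup-next-suc t y ys i = linked⇒R-next t y ys rs i

      linked-tabulate : ∀ {m} (f : Fin (suc m) → A) → (∀ i → R (f (inject₁ i)) (f (suc i))) → Linked R (tabulate f)
      linked-tabulate {zero}  f r = [-]
      linked-tabulate {suc m} f r = r zero ∷ linked-tabulate (λ i → f (suc i)) (λ i → r (suc i))

      R-next⇒linked : ∀ t x xs → (∀ i → R (lookup (x ∷ xs) i) (lookup (t ∷ xs) (next i))) → Linked R (x ∷ xs ++ [ t ])
      R-next⇒linked t x []       r = r zero ∷ [-]
      R-next⇒linked t x (y ∷ ys) r = r zero ∷ R-next⇒linked t y ys λ i →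
        subst (R (lookup (y ∷ ys) i)) (lookup-next-suc t y ys i) (r (suc i))

  module _ {n} {G : Graph n} where

    open import Data.List.Membership.DecPropositional (_≟_ {n}) using (_∈?_)

    cycleEdge-sym : ∀ {C : Cycle G} {u v} → CycleEdge C u v → CycleEdge C v u
    cycleEdge-sym (i , inj₁ (eu , ev)) = i , inj₂ (eu , ev)
    cycleEdge-sym (i , inj₂ (ev , eu)) = i , inj₁ (ev , eu)

    cycleEdge⇒edge : ∀ {C : Cycle G} {u v} → CycleEdge C u v → Edge G u v
    cycleEdge⇒edge {C} (i , inj₁ (refl , refl)) = edges C i
    cycleEdge⇒edge {C} (i , inj₂ (refl , refl)) = edge-sym G (edges C i)

    vertices : Cycle G → List (Fin n)
    vertices C = tabulate (vert C)

    OnCycle : Cycle G → Fin n → Set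
    OnCycle C x = x ∈ vertices C

    onCycle? : ∀ C → Decidable (OnCycle C)
    onCycle? C x = x ∈? vertices C

    vert-onCycle : ∀ (C : Cycle G) i → OnCycle C (vert C i)
    vert-onCycle C = ∈-tabulate⁺

    cycleEdge⇒onCycle : ∀ {C : Cycle G} {u v} → CycleEdge C u v → OnCycle C u × OnCycle C v
    cycleEdge⇒onCycle {C} (i , inj₁ (refl , refl)) = vert-onCycle C i , vert-onCycle C (next i)
    cycleEdge⇒onCycle {C} (i , inj₂ (refl , refl)) = vert-onCycle C (next i) , vert-onCycle C i

    vertices-unique : ∀ C → Unique (vertices C)
    vertices-unique C = Unique.tabulate⁺ (injective C _ _)

    vertices-linked : ∀ C → Linked (CycleEdge C) (vertices C)
    vertices-linked C = linked-tabulate (vert C) λ i → inject₁ i , inj₁ (refl , cong (vert C) (next-inject₁ i))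

    cycle-neighbours : ∀ (C : Cycle G) {x} → OnCycle C x → ∃₂ λ p q → CycleEdge C x p × CycleEdge C x q × p ≢ q
    cycle-neighbours C x∈C with ∈-tabulate⁻ {f = vert C} x∈C
    ... | i , refl = vert C (next i) , vert C (prev i) , (i , inj₁ (refl , refl)) ,
                     (prev i , inj₂ (refl , cong (vert C) (next-prev i))) , λ eq → next≢prev i (injective C _ _ eq)

    fromClosedList : ∀ z₀ z₁ z₂ zs → Unique (z₀ ∷ z₁ ∷ z₂ ∷ zs) → Linked (Edge G) (z₀ ∷ z₁ ∷ z₂ ∷ zs ++ [ z₀ ]) →
      Σ (Cycle G) λ N → Linked (CycleEdge N) (z₀ ∷ z₁ ∷ z₂ ∷ zs ++ [ z₀ ])
    fromClosedList z₀ z₁ z₂ zs zs! es = N , R-next⇒linked z₀ z₀ (z₁ ∷ z₂ ∷ zs) (λ i → i , inj₁ (refl , refl))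
      where
      N : Cycle G
      N = record { len₋₃    = length zs
                 ; vert      = lookup (z₀ ∷ z₁ ∷ z₂ ∷ zs)
                 ; injective = lookup-injective zs!
                 ; edges     = linked⇒R-next z₀ z₀ (z₁ ∷ z₂ ∷ zs) es }

module Cactus where

  open Lists
  open Walks
  open Cycles
  open import Data.Fin using (Fin)
  open import Data.Fin.Properties using (_≟_)
  open import Data.Empty using (⊥)
  open import Data.List using (List; []; _∷_; _++_; [_])
  open import Data.List.Properties using (++-assoc)
  open import Data.List.Membership.Propositional using (_∈_; _∉_)
  open import Data.List.Membership.Propositional.Properties using (∈-++⁻)
  open import Data.List.Relation.Binary.Subset.Propositional using (_⊆_)
  open import Data.List.Relation.Unary.Any using (here; there)
  open import Data.List.Relation.Unary.Linked using (Linked; _∷_)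
  import Data.List.Relation.Unary.Linked as Linked
  open import Data.List.Relation.Unary.Unique.Propositional using (Unique)
  open import Data.Product using (Σ; _×_; _,_; proj₁; proj₂)
  open import Data.Sum using (inj₁; inj₂; [_,_]′)
  open import Relation.Nullary using (¬_; yes; no; contradiction)
  open import Relation.Binary.PropositionalEquality using (_≡_; _≢_; refl; sym; trans; cong; subst)

  CactusCycles : ∀ {n} → Graph n → Set
  CactusCycles G = ∀ (C D : Cycle G) u v → CycleEdge C u v → CycleEdge D u v → SameCycle C D

  module _ {n} {G : Graph n} where

    cycle-from-paths : ∀ s ps t qs → Unique (s ∷ ps ++ t ∷ qs) →
      Linked (Edge G) (s ∷ ps ++ [ t ]) → Linked (Edge G) (t ∷ qs ++ [ s ]) → ¬ (ps ≡ [] × qs ≡ []) →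
      Σ (Cycle G) λ N → Linked (CycleEdge N) (s ∷ ps ++ t ∷ qs ++ [ s ])
    cycle-from-paths s ps t qs s! es₁ es₂ nondegenerate with ++-∷-atLeastTwo ps t qs nondegenerate
    ... | z₁ , z₂ , zs , eq with fromClosedList s z₁ z₂ zs (subst (λ l → Unique (s ∷ l)) eq s!)
                                   (subst (Linked (Edge G)) closed (linked-join (s ∷ ps) es₁ es₂))
      where
      closed : s ∷ ps ++ t ∷ qs ++ [ s ] ≡ s ∷ z₁ ∷ z₂ ∷ zs ++ [ s ]
      closed = cong (s ∷_) (trans (sym (++-assoc ps (t ∷ qs) [ s ])) (cong (_++ [ s ]) eq))
    ...   | N , cs = N , subst (λ l → Linked (CycleEdge N) (s ∷ l)) (trans (cong (_++ [ s ]) (sym eq)) (++-assoc ps (t ∷ qs) [ s ])) cs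

    arc⊆vertices : ∀ (C : Cycle G) {p q mid} → OnCycle C p → OnCycle C q → mid ⊆ vertices C → p ∷ mid ++ [ q ] ⊆ vertices C
    arc⊆vertices C p∈C q∈C mid⊆C (here refl) = p∈C
    arc⊆vertices C p∈C q∈C mid⊆C (there z∈) = [ mid⊆C , (λ { (here refl) → q∈C }) ]′ (∈-++⁻ _ z∈)

    -- The ear lemma. Closing the path a x ⋯ b up with an arc of C from b to a gives a
    -- cycle N; N and C share the arc's edge at a, so N = C and ax lies on C.
    module Ear (cactus : CactusCycles G) (C : Cycle G) {a b x} (a∈C : OnCycle C a) (a≢b : a ≢ b) (ax : Edge G a x)
               (q : Walk G x b) (q! : Unique (verts q)) (q∩C⊆b : ∀ {z} → z ∈ verts q → OnCycle C z → z ≡ b)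
               {mid : List (Fin n)} (mid⊆C : mid ⊆ vertices C) (a∉mid : a ∉ mid) (b∉mid : b ∉ mid) (mid! : Unique mid) where

      a∉q : a ∉ verts q
      a∉q a∈q = a≢b (q∩C⊆b a∈q a∈C)

      q∩mid≡∅ : ∀ {z} → z ∈ verts q → z ∉ mid
      q∩mid≡∅ z∈q z∈mid with q∩C⊆b z∈q (mid⊆C z∈mid)
      ... | refl = b∉mid z∈mid

      shared⇒cycleEdge : ∀ (N : Cycle G) {u v} → CycleEdge N u v → CycleEdge C u v → ∀ {y z} → CycleEdge N y z → CycleEdge C y z
      shared⇒cycleEdge N uvN uvC = proj₁ (cactus N C _ _ uvN uvC _ _)

      fromBackArc : Linked (CycleEdge C) (b ∷ mid ++ [ a ]) → CycleEdge C a x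
      fromBackArc arc with verts≡∷ʳ q
      ... | ws , q≡ws∷ʳb with head⁺-∷ʳ {xs = inner q} ws {y = b} (trans (sym (verts≡∷inner q)) q≡ws∷ʳb) | both-[]? ws mid
      ...   | refl | yes (refl , refl) = cycleEdge-sym {C = C} (linked-last [] {ys = []} arc)
      ...   | refl | no nondegenerate with cycle-from-paths a ws b mid cycle! path (Linked.map (cycleEdge⇒edge {C = C}) arc) nondegenerate
        where
        cycle! : Unique (a ∷ ws ++ b ∷ mid)
        cycle! = subst (λ l → Unique (a ∷ l)) (trans (cong (_++ mid) q≡ws∷ʳb) (++-assoc ws [ b ] mid))
          (unique-∷ (λ a∈ → [ a∉q , a∉mid ]′ (∈-++⁻ (verts q) a∈)) (unique-++ q! mid! q∩mid≡∅))
        path : Linked (Edge G) (a ∷ ws ++ [ b ])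
        path = subst (λ l → Linked (Edge G) (a ∷ l)) (trans (sym (verts≡∷inner q)) q≡ws∷ʳb)
                 (ax ∷ subst (Linked (Edge G)) (verts≡∷inner q) (verts-linked q))
      ...     | N , N-edges = shared⇒cycleEdge N (linked-last (a ∷ ws) N-edges) (linked-last [] arc) (linked-first ws N-edges)

      fromForwardArc : Linked (CycleEdge C) (a ∷ mid ++ [ b ]) → CycleEdge C a x
      fromForwardArc arc with toPath (reverseʷ q)
      ... | r , r! , r⊆q⁻¹ with both-[]? mid (inner r)
      ...   | yes (refl , inner≡[]) = subst (CycleEdge C a) (trans (cong (last⁺ b) (sym inner≡[])) (last⁺-inner r)) (linked-first [] arc)
      ...   | no nondegenerate with cycle-from-paths a mid b (inner r) cycle! (Linked.map (cycleEdge⇒edge {C = C}) arc) path nondegenerate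
        where
        r⊆q : verts r ⊆ verts q
        r⊆q z∈r = ∈-reverseʷ⁻ q (r⊆q⁻¹ z∈r)
        cycle! : Unique (a ∷ mid ++ b ∷ inner r)
        cycle! = subst (λ l → Unique (a ∷ mid ++ l)) (verts≡∷inner r)
          (unique-∷ (λ a∈ → [ a∉mid , (λ a∈r → a∉q (r⊆q a∈r)) ]′ (∈-++⁻ mid a∈))
                    (unique-++ mid! r! λ z∈mid z∈r → q∩mid≡∅ (r⊆q z∈r) z∈mid))
        path : Linked (Edge G) (b ∷ inner r ++ [ a ])
        path = subst (λ l → Linked (Edge G) (l ++ [ a ])) (verts≡∷inner r) (verts-linked-∷ʳ r (edge-sym G ax))
      ...     | N , N-edges = cycleEdge-sym {C = C} (subst (λ y → CycleEdge C y a) (last⁺-inner r)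
        (shared⇒cycleEdge N (linked-first mid N-edges) (linked-first mid arc) (linked-last (a ∷ mid) {ys = inner r} N-edges)))

    ear : CactusCycles G → (C : Cycle G) {a b x : Fin n} → OnCycle C a → OnCycle C b → a ≢ b → Edge G a x →
          (q : Walk G x b) → (∀ {z} → z ∈ verts q → OnCycle C z → z ≡ b) → CycleEdge C a x
    ear cactus C a∈C b∈C a≢b ax q₀ q₀∩C⊆b with toPath q₀
    ... | q , q! , q⊆q₀ with segment (vertices-unique C) (vertices-linked C) a∈C b∈C a≢b
    ...   | mid , arc , mid⊆C , a∉mid , b∉mid , mid! = [ fromForwardArc , fromBackArc ]′ arc
      where open Ear cactus C a∈C a≢b ax q q! (λ z∈q → q₀∩C⊆b (q⊆q₀ z∈q)) mid⊆C a∉mid b∉mid mid!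

    module _ (cactus : CactusCycles G) where

      -- Where Q leaves C for the last time, at some a ≢ v, it starts an ear ending in v
      -- through P; by the ear lemma its first edge would lie on C.
      attachment-separates : ∀ (C : Cycle G) {v u c} → OnCycle C v → (P : Walk G v u) →
        (∀ {z} → z ∈ verts P → OnCycle C z → z ≡ v) → u ≢ v →
        OnCycle C c → (Q : Walk G c u) → (∀ {z} → z ∈ verts Q → z ≢ v) → ⊥
      attachment-separates C {v} v∈C P P∩C⊆v u≢v c∈C Q Q∌v with lastVisit (OnCycle C) (onCycle? C) Q c∈C
      ... | a , a∈C , here       , _        , _   = u≢v (P∩C⊆v (end-∈ P) a∈C)
      ... | a , a∈C , step ax T , T∩C≡∅ , T⊆Q =
        T∩C≡∅ (start-∈ T) (proj₂ (cycleEdge⇒onCycle {C = C} (ear cactus C a∈C v∈C (Q∌v (T⊆Q (here refl))) ax (T ++ʷ reverseʷ P) TP∩C⊆v)))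
        where
        TP∩C⊆v : ∀ {z} → z ∈ verts (T ++ʷ reverseʷ P) → OnCycle C z → z ≡ v
        TP∩C⊆v z∈TP z∈C with ∈-++ʷ⁻ T (reverseʷ P) z∈TP
        ... | inj₁ z∈T  = contradiction z∈C (T∩C≡∅ z∈T)
        ... | inj₂ z∈P⁻¹ = P∩C⊆v (∈-reverseʷ⁻ P z∈P⁻¹) z∈C

      -- The arc starts an ear of C; by the ear lemma its first edge, an edge of D, lies on C.
      arc-joining⇒sameCycle : ∀ (C D : Cycle G) {s t mid} → OnCycle C s → OnCycle C t → s ≢ t →
        Linked (CycleEdge D) (s ∷ mid ++ [ t ]) → s ∉ mid → SameCycle C D
      arc-joining⇒sameCycle C D {s} {t} {mid} s∈C t∈C s≢t arc s∉mid
        with fromLinked mid t (Linked.map (cycleEdge⇒edge {C = D}) (Linked.tail arc))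
      ... | W , W≡mid∷ʳt with firstVisit (OnCycle C) (onCycle? C) W t∈C
      ...   | c , c∈C , T , T∩C⊆c , T⊆W = cactus C D s _ (ear cactus C s∈C c∈C s≢c sh T T∩C⊆c) shD
        where
        shD : CycleEdge D s (head⁺ mid t)
        shD = linked-first mid arc
        sh : Edge G s (head⁺ mid t)
        sh = cycleEdge⇒edge {C = D} shD
        s≢c : s ≢ c
        s≢c refl with ∈-++⁻ mid (subst (s ∈_) W≡mid∷ʳt (T⊆W (end-∈ T)))
        ... | inj₁ s∈mid       = s∉mid s∈mid
        ... | inj₂ (here s≡t) = s≢t s≡t

      shared-vertex-unique : ∀ (C D : Cycle G) → ¬ SameCycle C D → ∀ {x y} →
        OnCycle C x → OnCycle D x → OnCycle C y → OnCycle D y → x ≡ y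
      shared-vertex-unique C D C≠D {x} {y} x∈C x∈D y∈C y∈D with x ≟ y
      ... | yes x≡y = x≡y
      ... | no x≢y with segment (vertices-unique D) (vertices-linked D) x∈D y∈D x≢y
      ...   | mid , inj₁ arc , _ , x∉mid , _ , _ = contradiction (arc-joining⇒sameCycle C D x∈C y∈C x≢y arc x∉mid) C≠D
      ...   | mid , inj₂ arc , _ , _ , y∉mid , _ = contradiction (arc-joining⇒sameCycle C D y∈C x∈C (λ y≡x → x≢y (sym y≡x)) arc y∉mid) C≠D

      walkAlong : ∀ (C : Cycle G) {p q} → OnCycle C p → OnCycle C q → Σ (Walk G p q) λ W → verts W ⊆ vertices C
      walkAlong C {p} {q} p∈C q∈C with p ≟ q
      ... | yes refl = here , λ { (here refl) → p∈C }
      ... | no p≢q with segment (vertices-unique C) (vertices-linked C) p∈C q∈C p≢q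
      ...   | mid , inj₁ arc , mid⊆C , _ , _ , _ with fromLinked (p ∷ mid) q (Linked.map (cycleEdge⇒edge {C = C}) arc)
      ...     | W , W≡ = W , λ z∈W → arc⊆vertices C p∈C q∈C mid⊆C (subst (_ ∈_) W≡ z∈W)
      walkAlong C {p} {q} p∈C q∈C | no p≢q | mid , inj₂ arc , mid⊆C , _ , _ , _
        with fromLinked (q ∷ mid) p (Linked.map (cycleEdge⇒edge {C = C}) arc)
      ...     | W , W≡ = reverseʷ W , λ z∈W → arc⊆vertices C q∈C p∈C mid⊆C (subst (_ ∈_) W≡ (∈-reverseʷ⁻ W z∈W))

module Reach where

  open import Level using (0ℓ)
  open Lists
  open Walks
  open import Data.Nat using (ℕ; zero; suc; _+_; _<_; _≤′_; ≤′-refl; ≤′-step)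
  open import Data.Nat.Properties using (+-suc; +-identityʳ; ≤⇒≤′; ≤-trans; ≤-reflexive; <⇒≤)
  open import Data.Bool using (true)
  import Data.Bool.Properties as Bool
  open import Data.Fin using (Fin)
  open import Data.Fin.Properties using (_≟_; any?)
  open import Data.List.Membership.Propositional using (_∈_)
  open import Data.List.Relation.Unary.Any using (here; there)
  open import Data.Product using (Σ; ∃; _×_; _,_)
  open import Data.Sum using (_⊎_; inj₁; inj₂)
  open import Relation.Nullary using (¬?; _×-dec_; _⊎-dec_)
  open import Relation.Nullary.Decidable using (map′)
  open import Relation.Unary using (Pred; Decidable)
  open import Relation.Binary.PropositionalEquality using (_≢_; refl; sym; subst)

  module Reachability {n} (G : Graph n) (Source : Pred (Fin n) 0ℓ) (source? : Decidable Source) (a : Fin n) where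

    Avoids : ∀ {u w} → Walk G u w → Set
    Avoids p = ∀ {z} → z ∈ verts p → z ≢ a

    Reachable : Fin n → Set
    Reachable x = ∃ λ c → Source c × Σ (Walk G c x) Avoids

    ReachableIn : ℕ → Fin n → Set
    ReachableIn zero    x = Source x × x ≢ a
    ReachableIn (suc k) x = ReachableIn k x ⊎ (x ≢ a × ∃ λ y → Edge G y x × ReachableIn k y)

    reachableIn? : ∀ k → Decidable (ReachableIn k)
    reachableIn? zero    x = source? x ×-dec ¬? (x ≟ a)
    reachableIn? (suc k) x = reachableIn? k x ⊎-dec (¬? (x ≟ a) ×-dec any? λ y → (adj G y x Bool.≟ true) ×-dec reachableIn? k y)

    reachableIn-mono : ∀ {k m x} → k ≤′ m → ReachableIn k x → ReachableIn m x
    reachableIn-mono ≤′-refl        r = r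
    reachableIn-mono (≤′-step k≤′m) r = inj₁ (reachableIn-mono k≤′m r)

    source⇒reachable : ∀ {c} → Source c → c ≢ a → Reachable c
    source⇒reachable {c} s c≢a = c , s , here , λ { (here refl) → c≢a }

    reachable⇒≢ : ∀ {x} → Reachable x → x ≢ a
    reachable⇒≢ (c , s , p , p-avoids) = p-avoids (end-∈ p)

    reachable-along : ∀ {x y} → Reachable x → (p : Walk G x y) → Avoids p → Reachable y
    reachable-along (c , s , p , p-avoids) q q-avoids = c , s , p ++ʷ q , λ z∈ → avoids z∈
      where
      avoids : ∀ {z} → z ∈ verts (p ++ʷ q) → z ≢ a
      avoids z∈ with ∈-++ʷ⁻ p q z∈
      ... | inj₁ z∈p = p-avoids z∈p
      ... | inj₂ z∈q = q-avoids z∈q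

    reachable-step : ∀ {x y} → Reachable x → Edge G x y → y ≢ a → Reachable y
    reachable-step x∈ xy y≢a = reachable-along x∈ (step xy here) λ { (here refl) → reachable⇒≢ x∈ ; (there (here refl)) → y≢a }

    reachableIn⇒reachable : ∀ k {x} → ReachableIn k x → Reachable x
    reachableIn⇒reachable zero    (s , x≢a)                = source⇒reachable s x≢a
    reachableIn⇒reachable (suc k) (inj₁ r)                 = reachableIn⇒reachable k r
    reachableIn⇒reachable (suc k) (inj₂ (x≢a , y , e , r)) = reachable-step (reachableIn⇒reachable k r) e x≢a

    walk⇒reachableIn : ∀ k {c x} (p : Walk G c x) → Avoids p → ReachableIn k c → ReachableIn (lengthʷ p + k) x
    walk⇒reachableIn k here       _        r = r
    walk⇒reachableIn k {x = x} (step e p) p-avoids r = subst (λ m → ReachableIn m x) (+-suc (lengthʷ p) k)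
      (walk⇒reachableIn (suc k) p (λ z∈p → p-avoids (there z∈p)) (inj₂ (p-avoids (there (start-∈ p)) , _ , e , r)))

    -- a shortest avoiding walk has fewer than n steps
    reachable⇒reachableIn : ∀ {x} → Reachable x → ReachableIn n x
    reachable⇒reachableIn {x} (c , s , p , p-avoids) with toPath p
    ... | q , q! , q⊆p = reachableIn-mono (≤⇒≤′ (<⇒≤ q<n)) (subst (λ m → ReachableIn m x) (+-identityʳ (lengthʷ q))
                           (walk⇒reachableIn 0 q (λ z∈q → p-avoids (q⊆p z∈q)) (s , p-avoids (q⊆p (start-∈ q)))))
      where
      q<n : lengthʷ q < n
      q<n = ≤-trans (≤-reflexive (sym (length-verts q))) (unique-length≤ q!)

    reachable? : Decidable Reachable
    reachable? x = map′ (reachableIn⇒reachable n) reachable⇒reachableIn (reachableIn? n x)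

module NeighbourCount where

  open import Data.Nat using (ℕ; zero; suc; _+_; _≤_; s≤s)
  open import Data.Nat.Properties using (m≤m+n; m≤n+m; ≤-trans; ≤-reflexive; +-comm; +-monoʳ-≤)
  open import Data.Nat.ListAction using (sum)
  open import Data.Bool using (Bool; true; false; _∧_; if_then_else_)
  open import Data.Fin using (Fin; zero; suc)
  open import Data.Fin.Properties using (suc-injective; _≟_; any?)
  open import Data.List using (tabulate)
  open import Data.List.Properties using (map-tabulate)
  open import Data.Product using (∃; _×_; _,_)
  open import Relation.Nullary using (¬?; yes; no; _×-dec_; contradiction)
  open import Relation.Binary.Definitions using (DecidableEquality)
  import Data.Bool.Properties as Bool
  open import Relation.Binary.PropositionalEquality using (_≡_; _≢_; refl; sym; trans; cong)

  sum-tabulate-zero : ∀ {m} (h : Fin m → ℕ) → (∀ i → h i ≡ 0) → sum (tabulate h) ≡ 0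
  sum-tabulate-zero {zero}  h h≡0 = refl
  sum-tabulate-zero {suc m} h h≡0 rewrite h≡0 zero = sum-tabulate-zero (λ i → h (suc i)) (λ i → h≡0 (suc i))

  sum-tabulate-one : ∀ {m} (h : Fin m → ℕ) f → h f ≡ 1 → (∀ i → i ≢ f → h i ≡ 0) → sum (tabulate h) ≡ 1
  sum-tabulate-one {suc m} h zero    hf≡1 h≡0 rewrite hf≡1 = cong suc (sum-tabulate-zero (λ i → h (suc i)) (λ i → h≡0 (suc i) λ ()))
  sum-tabulate-one {suc m} h (suc f) hf≡1 h≡0 rewrite h≡0 zero (λ ()) =
    sum-tabulate-one (λ i → h (suc i)) f hf≡1 (λ i i≢f → h≡0 (suc i) (λ eq → i≢f (suc-injective eq)))

  sum-tabulate-≥ : ∀ {m} (h : Fin m → ℕ) i → h i ≤ sum (tabulate h)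
  sum-tabulate-≥ {suc m} h zero    = m≤m+n (h zero) _
  sum-tabulate-≥ {suc m} h (suc i) = ≤-trans (sum-tabulate-≥ (λ j → h (suc j)) i) (m≤n+m _ (h zero))

  sum-tabulate-≥₂ : ∀ {m} (h : Fin m → ℕ) i j → i ≢ j → h i + h j ≤ sum (tabulate h)
  sum-tabulate-≥₂ {suc m} h zero    zero    i≢j = contradiction refl i≢j
  sum-tabulate-≥₂ {suc m} h zero    (suc j) _   = +-monoʳ-≤ (h zero) (sum-tabulate-≥ (λ k → h (suc k)) j)
  sum-tabulate-≥₂ {suc m} h (suc i) zero    _   =
    ≤-trans (≤-reflexive (+-comm (h (suc i)) (h zero))) (+-monoʳ-≤ (h zero) (sum-tabulate-≥ (λ k → h (suc k)) i))
  sum-tabulate-≥₂ {suc m} h (suc i) (suc j) i≢j =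
    ≤-trans (sum-tabulate-≥₂ (λ k → h (suc k)) i j (λ eq → i≢j (cong suc eq))) (m≤n+m _ (h zero))

  isPart-refl : ∀ p → isPart p p ≡ true
  isPart-refl R  = refl
  isPart-refl W₁ = refl
  isPart-refl W₂ = refl

  isPart⇒≡ : ∀ p q → isPart p q ≡ true → q ≡ p
  isPart⇒≡ R  R  _ = refl
  isPart⇒≡ W₁ W₁ _ = refl
  isPart⇒≡ W₂ W₂ _ = refl

  _≟ᴾ_ : DecidableEquality Part
  R  ≟ᴾ R  = yes refl
  W₁ ≟ᴾ W₁ = yes refl
  W₂ ≟ᴾ W₂ = yes refl
  R  ≟ᴾ W₁ = no λ ()
  R  ≟ᴾ W₂ = no λ ()
  W₁ ≟ᴾ R  = no λ ()
  W₁ ≟ᴾ W₂ = no λ ()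
  W₂ ≟ᴾ R  = no λ ()
  W₂ ≟ᴾ W₁ = no λ ()

  module _ {n} (G : Graph n) (part : Fin n → Part) (v : Fin n) (p : Part) where

    InPart : Fin n → Bool
    InPart u = adj G v u ∧ isPart p (part u)

    inPart⇒ : ∀ u → InPart u ≡ true → Edge G v u × part u ≡ p
    inPart⇒ u eq with adj G v u
    ... | true = refl , isPart⇒≡ p (part u) eq

    ⇒inPart : ∀ u → Edge G v u → part u ≡ p → InPart u ≡ true
    ⇒inPart u e refl rewrite e = isPart-refl p

    nbrCount-tabulate : nbrCount G part v p ≡ sum (tabulate λ u → if InPart u then 1 else 0)
    nbrCount-tabulate = cong sum (map-tabulate (λ u → u) (λ u → if InPart u then 1 else 0))

    nbrCount-zero : (∀ u → Edge G v u → part u ≢ p) → nbrCount G part v p ≡ 0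
    nbrCount-zero none = trans nbrCount-tabulate (sum-tabulate-zero _ summand≡0)
      where
      summand≡0 : ∀ u → (if InPart u then 1 else 0) ≡ 0
      summand≡0 u with InPart u in eq
      ... | false = refl
      ... | true  = let (e , pu) = inPart⇒ u eq in contradiction pu (none u e)

    nbrCount-one : ∀ f → Edge G v f → part f ≡ p → (∀ u → Edge G v u → part u ≡ p → u ≡ f) → nbrCount G part v p ≡ 1
    nbrCount-one f e pf only = trans nbrCount-tabulate (sum-tabulate-one _ f summand-f summand≡0)
      where
      summand-f : (if InPart f then 1 else 0) ≡ 1
      summand-f rewrite ⇒inPart f e pf = refl
      summand≡0 : ∀ u → u ≢ f → (if InPart u then 1 else 0) ≡ 0
      summand≡0 u u≢f with InPart u in eq
      ... | false = refl
      ... | true  = let (e , pu) = inPart⇒ u eq in contradiction (only u e pu) u≢f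

    nbrCount-two : ∀ a b → a ≢ b → Edge G v a → part a ≡ p → Edge G v b → part b ≡ p → nbrCount G part v p ≢ 1
    nbrCount-two a b a≢b ea pa eb pb count≡1
      with ≤-trans (sum-tabulate-≥₂ (λ u → if InPart u then 1 else 0) a b a≢b) (≤-reflexive (trans (sym nbrCount-tabulate) count≡1))
    ... | two≤one rewrite ⇒inPart a ea pa | ⇒inPart b eb pb with two≤one
    ...   | s≤s ()

    nbrCount≢1⇒another : nbrCount G part v p ≢ 1 → ∀ f → Edge G v f → part f ≡ p → ∃ λ k → (Edge G v k × part k ≡ p) × k ≢ f
    nbrCount≢1⇒another count≢1 f e pf with any? (λ k → ((adj G v k Bool.≟ true) ×-dec (part k ≟ᴾ p)) ×-dec ¬? (k ≟ f))
    ... | yes another = another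
    ... | no ∄another = contradiction (nbrCount-one f e pf only) count≢1
      where
      only : ∀ u → Edge G v u → part u ≡ p → u ≡ f
      only u e pu with u ≟ f
      ... | yes u≡f = u≡f
      ... | no u≢f  = contradiction (u , (e , pu) , u≢f) ∄another

module BarbellPartitions where

  open Lists
  open Walks
  open Cycles
  open Cactus
  open Reach
  open NeighbourCount
  open import Data.Nat.Properties using (0≢1+n)
  open import Data.Fin using (Fin; zero)
  open import Data.Fin.Properties using (_≟_)
  open import Data.List.Membership.Propositional using (_∈_)
  open import Data.List.Relation.Unary.Any using (here; there)
  open import Data.Product using (∃; _×_; _,_; proj₂)
  open import Relation.Nullary using (¬_; yes; no; contradiction)
  open import Relation.Binary.PropositionalEquality using (_≡_; _≢_; refl; sym; trans; subst)

  module BarbellOfCycles {n} {G : Graph n} (cactus : CactusCycles G) (C D : Cycle G) (C≠D : ¬ SameCycle C D)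
    {v w} (v∈C : OnCycle C v) (w∈D : OnCycle D w) (P : Walk G v w)
    (P∩C⊆v : ∀ {z} → z ∈ verts P → OnCycle C z → z ≡ v) (P∩D⊆w : ∀ {z} → z ∈ verts P → OnCycle D z → z ≡ w) where

    module Reach₁ = Reachability G (OnCycle C) (onCycle? C) v
    module Reach₂ = Reachability G (OnCycle D) (onCycle? D) w
    open Reach₁ using () renaming (Reachable to InW₁)
    open Reach₂ using () renaming (Reachable to InW₂)

    w∉W₁ : ¬ InW₁ w
    w∉W₁ w∈W₁@(c , c∈C , Q , Q-avoids) with v ≟ w
    ... | yes refl = Reach₁.reachable⇒≢ w∈W₁ refl
    ... | no v≢w   = attachment-separates cactus C v∈C P P∩C⊆v (λ w≡v → v≢w (sym w≡v)) c∈C Q Q-avoids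

    v∉W₂ : ¬ InW₂ v
    v∉W₂ v∈W₂@(d , d∈D , Q , Q-avoids) with v ≟ w
    ... | yes refl = Reach₂.reachable⇒≢ v∈W₂ refl
    ... | no v≢w   = attachment-separates cactus D w∈D (reverseʷ P) (λ z∈ → P∩D⊆w (∈-reverseʷ⁻ P z∈)) v≢w d∈D Q Q-avoids

    D∩W₁≡∅ : ∀ {d} → OnCycle D d → ¬ InW₁ d
    D∩W₁≡∅ {d} d∈D d∈W₁@(c , c∈C , Q , Q-avoids) with v ≟ w
    ... | yes refl with walkAlong cactus D w∈D d∈D
    ...   | P′ , P′⊆D = attachment-separates cactus C v∈C P′ P′∩C⊆v (Reach₁.reachable⇒≢ d∈W₁) c∈C Q Q-avoids
      where
      P′∩C⊆v : ∀ {z} → z ∈ verts P′ → OnCycle C z → z ≡ v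
      P′∩C⊆v z∈P′ z∈C = shared-vertex-unique cactus C D C≠D z∈C (P′⊆D z∈P′) v∈C w∈D
    D∩W₁≡∅ {d} d∈D d∈W₁ | no v≢w with walkAlong cactus D d∈D w∈D
    ...   | P″ , P″⊆D = w∉W₁ (Reach₁.reachable-along d∈W₁ P″ λ z∈P″ z≡v →
                          v≢w (P∩D⊆w (start-∈ P) (subst (OnCycle D) z≡v (P″⊆D z∈P″))))

    W₁∩W₂≡∅ : ∀ {x} → InW₁ x → ¬ InW₂ x
    W₁∩W₂≡∅ x∈W₁ (d , d∈D , Q , Q-avoids) = D∩W₁≡∅ d∈D (Reach₁.reachable-along x∈W₁ (reverseʷ Q) Q⁻¹-avoids)
      where
      Q⁻¹-avoids : Reach₁.Avoids (reverseʷ Q)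
      Q⁻¹-avoids z∈ refl with prefixTo Q (∈-reverseʷ⁻ Q z∈)
      ... | Q′ , Q′⊆Q = v∉W₂ (d , d∈D , Q′ , λ z∈Q′ → Q-avoids (Q′⊆Q z∈Q′))

    part : Fin n → Part
    part x with Reach₁.reachable? x | Reach₂.reachable? x
    ... | yes _ | _     = W₁
    ... | no _  | yes _ = W₂
    ... | no _  | no _  = R

    part≡W₁⇒ : ∀ {x} → part x ≡ W₁ → InW₁ x
    part≡W₁⇒ {x} eq with Reach₁.reachable? x | Reach₂.reachable? x
    part≡W₁⇒ refl | yes x∈W₁ | _ = x∈W₁
    part≡W₁⇒ ()   | no _     | yes _
    part≡W₁⇒ ()   | no _     | no _

    ⇒part≡W₁ : ∀ {x} → InW₁ x → part x ≡ W₁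
    ⇒part≡W₁ {x} x∈W₁ with Reach₁.reachable? x
    ... | yes _    = refl
    ... | no x∉W₁ = contradiction x∈W₁ x∉W₁

    part≡W₂⇒ : ∀ {x} → part x ≡ W₂ → InW₂ x
    part≡W₂⇒ {x} eq with Reach₁.reachable? x | Reach₂.reachable? x
    part≡W₂⇒ ()   | yes _ | _
    part≡W₂⇒ refl | no _  | yes x∈W₂ = x∈W₂
    part≡W₂⇒ ()   | no _  | no _

    ⇒part≡W₂ : ∀ {x} → InW₂ x → part x ≡ W₂
    ⇒part≡W₂ {x} x∈W₂ with Reach₁.reachable? x | Reach₂.reachable? x
    ... | yes x∈W₁ | _        = contradiction x∈W₂ (W₁∩W₂≡∅ x∈W₁)
    ... | no _     | yes _    = refl
    ... | no _     | no x∉W₂ = contradiction x∈W₂ x∉W₂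

    part≡R⇒ : ∀ {x} → part x ≡ R → ¬ InW₁ x × ¬ InW₂ x
    part≡R⇒ {x} eq with Reach₁.reachable? x | Reach₂.reachable? x
    part≡R⇒ ()   | yes _    | _
    part≡R⇒ ()   | no _     | yes _
    part≡R⇒ refl | no x∉W₁ | no x∉W₂ = x∉W₁ , x∉W₂

    module Side (K : Cycle G) {a} (a∈K : OnCycle K a) (p : Part)
                (toPart : ∀ {x} → Reachability.Reachable G (OnCycle K) (onCycle? K) a x → part x ≡ p)
                (fromPart : ∀ {x} → part x ≡ p → Reachability.Reachable G (OnCycle K) (onCycle? K) a x) where

      open Reachability G (OnCycle K) (onCycle? K) a

      neighbour-reachable : ∀ {x} → CycleEdge K a x → Reachable x
      neighbour-reachable ax = source⇒reachable (proj₂ (cycleEdge⇒onCycle {C = K} ax))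
        λ x≡a → edge-irrefl G (cycleEdge⇒edge {C = K} ax) (sym x≡a)

      nonempty : ∃ λ x → part x ≡ p
      nonempty with cycle-neighbours K a∈K
      ... | x , _ , ax , _ , _ = x , toPart (neighbour-reachable ax)

      nbrCount≢1 : ∀ r → ¬ Reachable r → nbrCount G part r p ≢ 1
      nbrCount≢1 r r∉ with r ≟ a
      ... | yes refl with cycle-neighbours K a∈K
      ...   | x , y , ax , ay , x≢y = nbrCount-two G part r p x y x≢y
              (cycleEdge⇒edge {C = K} ax) (toPart (neighbour-reachable ax)) (cycleEdge⇒edge {C = K} ay) (toPart (neighbour-reachable ay))
      nbrCount≢1 r r∉ | no r≢a = λ count≡1 → 0≢1+n (trans (sym (nbrCount-zero G part r p none)) count≡1)
        where
        none : ∀ u → Edge G r u → part u ≢ p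
        none u ru pu = r∉ (reachable-step (fromPart pu) (edge-sym G ru) r≢a)

    module Side₁ = Side C v∈C W₁ ⇒part≡W₁ part≡W₁⇒
    module Side₂ = Side D w∈D W₂ ⇒part≡W₂ part≡W₂⇒

    no-W₁W₂-edge : ∀ x y → part x ≡ W₁ → part y ≡ W₂ → ¬ Edge G x y
    no-W₁W₂-edge x y px py xy with y ≟ v
    ... | yes refl = v∉W₂ (part≡W₂⇒ py)
    ... | no y≢v   = W₁∩W₂≡∅ (Reach₁.reachable-step (part≡W₁⇒ px) xy y≢v) (part≡W₂⇒ py)

    barbellPartition : BarbellPartition G
    barbellPartition = record
      { part         = part
      ; W₁-nonempty  = Side₁.nonempty
      ; W₂-nonempty  = Side₂.nonempty
      ; no-W₁W₂-edge = no-W₁W₂-edge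
      ; R-condition  = λ r pr → let (r∉W₁ , r∉W₂) = part≡R⇒ pr in Side₁.nbrCount≢1 r r∉W₁ , Side₂.nbrCount≢1 r r∉W₂
      }

  -- v is the last vertex of C on a walk from C to D, and w the first vertex of D after v.
  cactus⇒barbellPartition : ∀ {n} (G : Graph n) → IsCactus G → AtLeastTwoCycles G → BarbellPartition G
  cactus⇒barbellPartition G (connected , cactus) (C , D , C≠D)
    with lastVisit (OnCycle C) (onCycle? C) (connected (vert C zero) (vert D zero)) (vert-onCycle C zero)
  ... | v , v∈C , S , S∩C≡∅ , _ with firstVisit (OnCycle D) (onCycle? D) S (vert-onCycle D zero)
  ...   | w , w∈D , P , P∩D⊆w , P⊆S = BarbellOfCycles.barbellPartition cactus C D C≠D v∈C w∈D P P∩C⊆v P∩D⊆w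
    where
    P∩C⊆v : ∀ {z} → z ∈ verts P → OnCycle C z → z ≡ v
    P∩C⊆v z∈P z∈C with subst (_ ∈_) (verts≡∷inner S) (P⊆S z∈P)
    ... | here z≡v    = z≡v
    ... | there z∈S′ = contradiction z∈C (S∩C≡∅ z∈S′)

module StrongSpectralProperty where

  open import Level using (0ℓ)
  open NeighbourCount using (_≟ᴾ_; nbrCount≢1⇒another)
  open Walks using (edge-sym)
  open import Data.Nat using (ℕ; zero; suc)
  open import Data.Bool using (if_then_else_; true; false)
  import Data.Bool.Properties as Bool
  open import Data.Fin using (Fin; zero; suc)
  open import Data.Fin.Properties using (_≟_; any?)
  open import Data.Product using (∃; _×_; _,_; proj₁; proj₂)
  open import Data.Sum using (inj₁; inj₂)
  open import Data.Empty using (⊥)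
  open import Relation.Nullary using (¬_; Dec; ¬?; yes; no; does; _×-dec_; contradiction)
  open import Relation.Unary using (Pred; Decidable)
  open import Relation.Binary.PropositionalEquality as ≡ using (_≡_; _≢_)
  open import Algebra.Bundles using (CommutativeRing)
  import Algebra.Properties.Ring as RingProperties
  import Algebra.Properties.Semiring.Sum as SemiringSum

  module _ (ℝ : RealField) where

    open RealField ℝ
    open CommutativeRing cring using (-_; semiring; ring; setoid; refl; reflexive; sym; trans; +-cong; +-congˡ; +-congʳ; *-cong; *-congˡ; *-congʳ;
      +-comm; *-comm; *-assoc; +-identityˡ; +-identityʳ; *-identityˡ; *-identityʳ; zeroˡ; zeroʳ; distribˡ;
      -‿cong; -‿inverseˡ; -‿inverseʳ)
    open RingProperties ring using (-‿distribˡ-*; -‿involutive; -0#≈0#)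
    open SemiringSum semiring using (sum; sum-cong-≋; ∑-distrib-+; *-distribʳ-sum; sum-replicate-zero)
    open import Relation.Binary.Reasoning.Setoid setoid

    sumF≡sum : ∀ {m} (f : Fin m → Carrier) → sumF ℝ f ≡ sum f
    sumF≡sum {zero}  f = ≡.refl
    sumF≡sum {suc m} f = ≡.cong (f zero +_) (sumF≡sum (λ i → f (suc i)))

    sum-zero : ∀ {m} {f : Fin m → Carrier} → (∀ i → f i ≈ 0#) → sum f ≈ 0#
    sum-zero {m} f≈0 = trans (sum-cong-≋ f≈0) (sum-replicate-zero m)

    sum-δ : ∀ {m} (i : Fin m) c → sum (λ k → if does (i ≟ k) then c else 0#) ≈ c
    sum-δ {suc m} zero    c = trans (+-congˡ (sum-replicate-zero m)) (+-identityʳ c)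
    sum-δ {suc m} (suc i) c = trans (+-identityˡ _) (sum-δ i c)

    module _ {n : ℕ} where

      Annihilates : Matrix ℝ n → (Fin n → Carrier) → Set
      Annihilates A u = ∀ i → sum (λ k → A i k * u k) ≈ 0#

      outerSym : (u v : Fin n → Carrier) → Matrix ℝ n
      outerSym u v i j = u i * v j + v i * u j

      outerSym-symmetric : ∀ u v → Symmetric ℝ (outerSym u v)
      outerSym-symmetric u v i j = trans (+-comm _ _) (+-cong (*-comm _ _) (*-comm _ _))

      ⊗-transpose : ∀ {A B : Matrix ℝ n} → Symmetric ℝ A → Symmetric ℝ B → ∀ i j → _⊗_ ℝ A B i j ≈ _⊗_ ℝ B A j i
      ⊗-transpose {A} {B} A-sym B-sym i j = begin
        sumF ℝ (λ k → A i k * B k j) ≡⟨ sumF≡sum (λ k → A i k * B k j) ⟩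
        sum (λ k → A i k * B k j)    ≈⟨ sum-cong-≋ (λ k → trans (*-comm _ _) (*-cong (B-sym k j) (A-sym i k))) ⟩
        sum (λ k → B j k * A k i)    ≡⟨ sumF≡sum (λ k → B j k * A k i) ⟨
        sumF ℝ (λ k → B j k * A k i) ∎

      annihilates⇒⊗-outerSym≈0 : ∀ {A u v} → Annihilates A u → Annihilates A v → ∀ i j → _⊗_ ℝ A (outerSym u v) i j ≈ 0#
      annihilates⇒⊗-outerSym≈0 {A} {u} {v} Au≈0 Av≈0 i j = begin
        sumF ℝ (λ k → A i k * (u k * v j + v k * u j))              ≡⟨ sumF≡sum (λ k → A i k * (u k * v j + v k * u j)) ⟩
        sum (λ k → A i k * (u k * v j + v k * u j))
          ≈⟨ sum-cong-≋ (λ k → trans (distribˡ (A i k) _ _) (+-cong (sym (*-assoc (A i k) (u k) (v j))) (sym (*-assoc (A i k) (v k) (u j))))) ⟩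
        sum (λ k → A i k * u k * v j + A i k * v k * u j)
          ≈⟨ ∑-distrib-+ (λ k → A i k * u k * v j) (λ k → A i k * v k * u j) ⟩
        sum (λ k → A i k * u k * v j) + sum (λ k → A i k * v k * u j)
          ≈⟨ +-cong (*-distribʳ-sum (v j) (λ k → A i k * u k)) (*-distribʳ-sum (u j) (λ k → A i k * v k)) ⟨
        sum (λ k → A i k * u k) * v j + sum (λ k → A i k * v k) * u j
          ≈⟨ +-cong (*-congʳ (Au≈0 i)) (*-congʳ (Av≈0 i)) ⟩
        0# * v j + 0# * u j                                         ≈⟨ +-cong (zeroˡ _) (zeroˡ _) ⟩
        0# + 0#                                                     ≈⟨ +-identityˡ 0# ⟩
        0#                                                          ∎

      annihilates⇒¬SSP : ∀ {A u v} → Symmetric ℝ A → Annihilates A u → Annihilates A v →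
        IsZeroM ℝ (_∘ₕ_ ℝ A (outerSym u v)) → IsZeroM ℝ (_∘ₕ_ ℝ (idM ℝ) (outerSym u v)) → ¬ IsZeroM ℝ (outerSym u v) → ¬ HasSSP ℝ A
      annihilates⇒¬SSP {A} {u} {v} A-sym Au≈0 Av≈0 A∘X≈0 I∘X≈0 X≉0 ssp =
        X≉0 (ssp (outerSym u v) (outerSym-symmetric u v) A∘X≈0 I∘X≈0 λ i j →
          trans (AX≈0 i j) (sym (trans (⊗-transpose (outerSym-symmetric u v) A-sym i j) (AX≈0 j i))))
        where
        AX≈0 = annihilates⇒⊗-outerSym≈0 Au≈0 Av≈0

    -[x+y]+x≈0 : ∀ {x y} → y ≈ 0# → - (x + y) + x ≈ 0#
    -[x+y]+x≈0 {x} {y} y≈0 = begin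
      - (x + y) + x   ≈⟨ +-congʳ (-‿cong (+-congˡ y≈0)) ⟩
      - (x + 0#) + x  ≈⟨ +-congʳ (-‿cong (+-identityʳ x)) ⟩
      - x + x         ≈⟨ -‿inverseˡ x ⟩
      0#              ∎

    -[x+y]+y≈0 : ∀ {x y} → x ≈ 0# → - (x + y) + y ≈ 0#
    -[x+y]+y≈0 {x} {y} x≈0 = trans (+-congʳ (-‿cong (+-comm x y))) (-[x+y]+x≈0 x≈0)

    0≤1 : 0# ≤ 1#
    0≤1 with ≤-total 0# 1#
    ... | inj₁ 0≤1 = 0≤1
    ... | inj₂ 1≤0 = ≤-resp-≈ refl -1*-1≈1 (*-nonneg 0≤-1 0≤-1)
      where
      0≤-1 : 0# ≤ (- 1#)
      0≤-1 = ≤-resp-≈ (-‿inverseʳ 1#) (+-identityˡ (- 1#)) (+-mono-≤ (- 1#) 1≤0)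
      -1*-1≈1 : (- 1#) * (- 1#) ≈ 1#
      -1*-1≈1 = begin
        (- 1#) * (- 1#) ≈⟨ -‿distribˡ-* 1# (- 1#) ⟨
        - (1# * (- 1#)) ≈⟨ -‿cong (*-identityˡ (- 1#)) ⟩
        - (- 1#)        ≈⟨ -‿involutive 1# ⟩
        1#              ∎

    1≤⇒≉0 : ∀ {x} → 1# ≤ x → ¬ x ≈ 0#
    1≤⇒≉0 1≤x x≈0 = 0≉1 (≤-antisym 0≤1 (≤-resp-≈ refl x≈0 1≤x))

    0≤-+ : ∀ {x y} → 0# ≤ x → 0# ≤ y → 0# ≤ (x + y)
    0≤-+ {x} {y} 0≤x 0≤y = ≤-trans 0≤y (≤-resp-≈ (+-identityˡ y) refl (+-mono-≤ y 0≤x))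

    sum-nonneg : ∀ {m} (f : Fin m → Carrier) → (∀ i → 0# ≤ f i) → 0# ≤ sum f
    sum-nonneg {zero}  f 0≤f = ≤-refl
    sum-nonneg {suc m} f 0≤f = 0≤-+ (0≤f zero) (sum-nonneg (λ i → f (suc i)) (λ i → 0≤f (suc i)))

    term≤sum : ∀ {m} (f : Fin m → Carrier) → (∀ i → 0# ≤ f i) → ∀ i → f i ≤ sum f
    term≤sum {suc m} f 0≤f zero    = ≤-resp-≈ (+-identityˡ (f zero)) (+-comm _ _)
      (+-mono-≤ (f zero) (sum-nonneg (λ i → f (suc i)) (λ i → 0≤f (suc i))))
    term≤sum {suc m} f 0≤f (suc i) = ≤-trans (term≤sum (λ j → f (suc j)) (λ j → 0≤f (suc j)) i)
      (≤-resp-≈ (+-identityˡ _) refl (+-mono-≤ _ (0≤f zero)))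

    indicator : ∀ {A : Set} → Dec A → Carrier
    indicator a? = if does a? then 1# else 0#

    indicator-nonneg : ∀ {A : Set} (a? : Dec A) → 0# ≤ indicator a?
    indicator-nonneg (yes _) = 0≤1
    indicator-nonneg (no _)  = ≤-refl

    -- Weights on a decidable set N summing to 0: some f ∈ N gets minus the number of
    -- the other elements of N, which get 1; they are nonzero on N unless N is a singleton.
    module _ {m} {N : Pred (Fin m) 0ℓ} (N? : Decidable N) where

      othersThan : Fin m → Fin m → Carrier
      othersThan f k = indicator (N? k ×-dec ¬? (k ≟ f))

      zeroSumWeights : Fin m → Carrier
      zeroSumWeights k with any? N?
      ... | no _       = 0#
      ... | yes (f , _) = (if does (f ≟ k) then - sum (othersThan f) else 0#) + othersThan f k

      zeroSumWeights-sum : sum zeroSumWeights ≈ 0#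
      zeroSumWeights-sum with any? N?
      ... | no _        = sum-replicate-zero m
      ... | yes (f , _) = begin
        sum (λ k → (if does (f ≟ k) then - sum (othersThan f) else 0#) + othersThan f k)
          ≈⟨ ∑-distrib-+ (λ k → if does (f ≟ k) then - sum (othersThan f) else 0#) (othersThan f) ⟩
        sum (λ k → if does (f ≟ k) then - sum (othersThan f) else 0#) + sum (othersThan f)
          ≈⟨ +-congʳ (sum-δ f (- sum (othersThan f))) ⟩
        - sum (othersThan f) + sum (othersThan f)
          ≈⟨ -‿inverseˡ (sum (othersThan f)) ⟩
        0# ∎

      zeroSumWeights-outside : ∀ k → ¬ N k → zeroSumWeights k ≈ 0#
      zeroSumWeights-outside k ¬Nk with any? N?
      ... | no _         = refl
      ... | yes (f , Nf) with f ≟ k | N? k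
      ...   | yes ≡.refl | _      = contradiction Nf ¬Nk
      ...   | no _       | yes Nk = contradiction Nk ¬Nk
      ...   | no _       | no _   = +-identityˡ 0#

      zeroSumWeights-inside : (∀ f → N f → ∃ λ k → N k × k ≢ f) → ∀ k → N k → ¬ zeroSumWeights k ≈ 0#
      zeroSumWeights-inside notSingleton k Nk with any? N?
      ... | no ∄N        = contradiction (k , Nk) ∄N
      ... | yes (f , Nf) with f ≟ k | N? k | k ≟ f
      ...   | _          | no ¬Nk | _       = contradiction Nk ¬Nk
      ...   | yes ≡.refl | yes _  | no k≢f  = contradiction ≡.refl k≢f
      ...   | no f≢k     | yes _  | yes k≡f = contradiction (≡.sym k≡f) f≢k
      ...   | no _       | yes _  | no _    = λ w≈0 → 0≉1 (sym (trans (sym (+-identityˡ 1#)) w≈0))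
      ...   | yes ≡.refl | yes _  | yes _   = λ w≈0 → others≉0 (begin
        sum (othersThan f)         ≈⟨ -‿involutive (sum (othersThan f)) ⟨
        - (- sum (othersThan f))   ≈⟨ -‿cong (trans (sym (+-identityʳ (- sum (othersThan f)))) w≈0) ⟩
        - 0#                       ≈⟨ -0#≈0# ⟩
        0#                         ∎)
        where
        others≉0 : ¬ sum (othersThan f) ≈ 0#
        others≉0 with notSingleton f Nf
        ... | k′ , Nk′ , k′≢f = 1≤⇒≉0 (≤-trans (≤-resp-≈ refl 1≈others-k′ ≤-refl)
                                              (term≤sum (othersThan f) (λ k → indicator-nonneg (N? k ×-dec ¬? (k ≟ f))) k′))
          where
          1≈others-k′ : 1# ≈ othersThan f k′
          1≈others-k′ with N? k′ | k′ ≟ f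
          ... | yes _   | no _     = refl
          ... | no ¬Nk′ | _        = contradiction Nk′ ¬Nk′
          ... | yes _   | yes k′≡f = contradiction k′≡f k′≢f

    module BarbellMatrix {n} (G : Graph n) (B : BarbellPartition G) where

      open BarbellPartition B

      NbrIn : Part → Fin n → Pred (Fin n) 0ℓ
      NbrIn p r k = Edge G r k × part k ≡ p

      nbrIn? : ∀ p r → Decidable (NbrIn p r)
      nbrIn? p r k = (adj G r k Bool.≟ true) ×-dec (part k ≟ᴾ p)

      weight : Part → Fin n → Fin n → Carrier
      weight p r = zeroSumWeights (nbrIn? p r)

      edgeWeight : Part → Part → Fin n → Fin n → Carrier
      edgeWeight R  W₁ i j = weight W₁ i j
      edgeWeight R  W₂ i j = weight W₂ i j
      edgeWeight W₁ R  i j = weight W₁ j i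
      edgeWeight W₂ R  i j = weight W₂ j i
      edgeWeight R  R  _ _ = 1#
      edgeWeight W₁ W₁ _ _ = 1#
      edgeWeight W₁ W₂ _ _ = 1#
      edgeWeight W₂ W₁ _ _ = 1#
      edgeWeight W₂ W₂ _ _ = 1#

      edgeWeight-sym : ∀ p q i j → edgeWeight p q i j ≡ edgeWeight q p j i
      edgeWeight-sym R  R  _ _ = ≡.refl
      edgeWeight-sym R  W₁ _ _ = ≡.refl
      edgeWeight-sym R  W₂ _ _ = ≡.refl
      edgeWeight-sym W₁ R  _ _ = ≡.refl
      edgeWeight-sym W₁ W₁ _ _ = ≡.refl
      edgeWeight-sym W₁ W₂ _ _ = ≡.refl
      edgeWeight-sym W₂ R  _ _ = ≡.refl
      edgeWeight-sym W₂ W₁ _ _ = ≡.refl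
      edgeWeight-sym W₂ W₂ _ _ = ≡.refl

      offDiag : Matrix ℝ n
      offDiag i j = if adj G i j then edgeWeight (part i) (part j) i j else 0#

      𝟙 : Part → Fin n → Carrier
      𝟙 p k = indicator (part k ≟ᴾ p)

      rowSum : Part → Fin n → Carrier
      rowSum p i = sum (λ k → offDiag i k * 𝟙 p k)

      -- The weights make the rows of R annihilate 𝟙 W₁ and 𝟙 W₂; the diagonal does it for W₁ ∪ W₂.
      diag : Fin n → Carrier
      diag i = - (rowSum W₁ i + rowSum W₂ i)

      A : Matrix ℝ n
      A i j = if does (i ≟ j) then diag i else offDiag i j

      offDiag-sym : ∀ i j → offDiag i j ≡ offDiag j i
      offDiag-sym i j rewrite adj-sym G i j | edgeWeight-sym (part i) (part j) i j = ≡.refl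

      A≡offDiag : ∀ {i j} → i ≢ j → A i j ≡ offDiag i j
      A≡offDiag {i} {j} i≢j with i ≟ j
      ... | yes i≡j = contradiction i≡j i≢j
      ... | no _    = ≡.refl

      A-symmetric : Symmetric ℝ A
      A-symmetric i j with i ≟ j | j ≟ i
      ... | yes ≡.refl | yes _    = refl
      ... | yes i≡j    | no j≢i   = contradiction (≡.sym i≡j) j≢i
      ... | no i≢j     | yes j≡i  = contradiction (≡.sym j≡i) i≢j
      ... | no _       | no _     = reflexive (offDiag-sym i j)

      weight-nonzero : ∀ {r p} → nbrCount G part r p ≢ 1 → ∀ k → NbrIn p r k → ¬ weight p r k ≈ 0#
      weight-nonzero {r} {p} count≢1 = zeroSumWeights-inside (nbrIn? p r)
        λ f (rf , pf) → nbrCount≢1⇒another G part r p count≢1 f rf pf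

      1≉0 : ¬ 1# ≈ 0#
      1≉0 1≈0 = 0≉1 (sym 1≈0)

      edgeWeight-nonzero : ∀ {i j} → Edge G i j → ¬ edgeWeight (part i) (part j) i j ≈ 0#
      edgeWeight-nonzero {i} {j} ij with part i in pi | part j in pj
      ... | R  | W₁ = weight-nonzero (proj₁ (R-condition i pi)) j (ij , pj)
      ... | R  | W₂ = weight-nonzero (proj₂ (R-condition i pi)) j (ij , pj)
      ... | W₁ | R  = weight-nonzero (proj₁ (R-condition j pj)) i (edge-sym G ij , pi)
      ... | W₂ | R  = weight-nonzero (proj₂ (R-condition j pj)) i (edge-sym G ij , pi)
      ... | R  | R  = 1≉0
      ... | W₁ | W₁ = 1≉0
      ... | W₁ | W₂ = 1≉0
      ... | W₂ | W₁ = 1≉0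
      ... | W₂ | W₂ = 1≉0

      A∈S : InS ℝ G A
      A∈S = A-symmetric , λ i j i≢j → nonzero⇒edge i≢j , edge⇒nonzero i≢j
        where
        nonzero⇒edge : ∀ {i j} → i ≢ j → ¬ A i j ≈ 0# → Edge G i j
        nonzero⇒edge {i} {j} i≢j Aij≉0 rewrite A≡offDiag i≢j with adj G i j
        ... | true  = ≡.refl
        ... | false = contradiction refl Aij≉0
        edge⇒nonzero : ∀ {i j} → i ≢ j → Edge G i j → ¬ A i j ≈ 0#
        edge⇒nonzero {i} {j} i≢j ij rewrite A≡offDiag i≢j | ij = edgeWeight-nonzero ij

      𝟙-≡ : ∀ {p k} → part k ≡ p → 𝟙 p k ≈ 1#
      𝟙-≡ {p} {k} pk with part k ≟ᴾ p
      ... | yes _  = refl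
      ... | no ¬pk = contradiction pk ¬pk

      𝟙-≢ : ∀ {p k} → part k ≢ p → 𝟙 p k ≈ 0#
      𝟙-≢ {p} {k} ¬pk with part k ≟ᴾ p
      ... | yes pk = contradiction pk ¬pk
      ... | no _   = refl

      A-row : ∀ p i → sum (λ k → A i k * 𝟙 p k) ≈ diag i * 𝟙 p i + rowSum p i
      A-row p i = begin
        sum (λ k → A i k * 𝟙 p k)                                          ≈⟨ sum-cong-≋ split ⟩
        sum (λ k → (if does (i ≟ k) then diag i * 𝟙 p i else 0#) + offDiag i k * 𝟙 p k)
          ≈⟨ ∑-distrib-+ (λ k → if does (i ≟ k) then diag i * 𝟙 p i else 0#) (λ k → offDiag i k * 𝟙 p k) ⟩
        sum (λ k → if does (i ≟ k) then diag i * 𝟙 p i else 0#) + rowSum p i ≈⟨ +-congʳ (sum-δ i (diag i * 𝟙 p i)) ⟩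
        diag i * 𝟙 p i + rowSum p i                                        ∎
        where
        split : ∀ k → A i k * 𝟙 p k ≈ (if does (i ≟ k) then diag i * 𝟙 p i else 0#) + offDiag i k * 𝟙 p k
        split k with i ≟ k
        ... | yes ≡.refl rewrite irrefl G i = sym (trans (+-congˡ (zeroˡ (𝟙 p i))) (+-identityʳ _))
        ... | no _ = sym (+-identityˡ _)

      rowSum-noNbr : ∀ {p i} → (∀ k → Edge G i k → part k ≢ p) → rowSum p i ≈ 0#
      rowSum-noNbr {p} {i} none = sum-zero term≈0
        where
        term≈0 : ∀ k → offDiag i k * 𝟙 p k ≈ 0#
        term≈0 k with adj G i k in ik
        ... | false = zeroˡ (𝟙 p k)
        ... | true  = trans (*-congˡ (𝟙-≢ (none k ik))) (zeroʳ _)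

      rowSum-W₁→W₂ : ∀ {i} → part i ≡ W₁ → rowSum W₂ i ≈ 0#
      rowSum-W₁→W₂ {i} pi = rowSum-noNbr λ k ik pk → no-W₁W₂-edge i k pi pk ik

      rowSum-W₂→W₁ : ∀ {i} → part i ≡ W₂ → rowSum W₁ i ≈ 0#
      rowSum-W₂→W₁ {i} pi = rowSum-noNbr λ k ik pk → no-W₁W₂-edge k i pk pi (edge-sym G ik)

      rowSum-R : ∀ {p i} → p ≢ R → part i ≡ R → rowSum p i ≈ 0#
      rowSum-R {p} {i} p≢R pi = trans (sum-cong-≋ term≈weight) (zeroSumWeights-sum (nbrIn? p i))
        where
        term≈weight : ∀ k → offDiag i k * 𝟙 p k ≈ weight p i k
        term≈weight k with adj G i k in ik | part k ≟ᴾ p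
        ... | false | _   = trans (zeroˡ _) (sym (zeroSumWeights-outside (nbrIn? p i) k λ (ik′ , _) → contradiction (≡.trans (≡.sym ik) ik′) λ ()))
        ... | true  | no ¬pk = trans (zeroʳ _) (sym (zeroSumWeights-outside (nbrIn? p i) k λ (_ , pk) → ¬pk pk))
        ... | true  | yes pk rewrite pi | pk = trans (*-identityʳ _) (toR p p≢R)
          where
          toR : ∀ p → p ≢ R → edgeWeight R p i k ≈ weight p i k
          toR R  p≢R = contradiction ≡.refl p≢R
          toR W₁ _   = refl
          toR W₂ _   = refl

      A-annihilates : ∀ p → p ≢ R → Annihilates A (𝟙 p)
      A-annihilates p p≢R i = trans (A-row p i) (vanish p (part i) p≢R ≡.refl)
        where
        outside : ∀ {p q} → part i ≡ q → q ≢ p → rowSum p i ≈ 0# → diag i * 𝟙 p i + rowSum p i ≈ 0#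
        outside pi q≢p S≈0 = trans (+-cong (trans (*-congˡ (𝟙-≢ λ pi′ → q≢p (≡.trans (≡.sym pi) pi′))) (zeroʳ _)) S≈0) (+-identityˡ 0#)
        inside : ∀ {p} → part i ≡ p → diag i * 𝟙 p i + rowSum p i ≈ diag i + rowSum p i
        inside pi = +-congʳ (trans (*-congˡ (𝟙-≡ pi)) (*-identityʳ _))
        vanish : ∀ p q → p ≢ R → part i ≡ q → diag i * 𝟙 p i + rowSum p i ≈ 0#
        vanish R  _  p≢R _  = contradiction ≡.refl p≢R
        vanish p  R  p≢R pi = outside pi (λ R≡p → p≢R (≡.sym R≡p)) (rowSum-R p≢R pi)
        vanish W₁ W₁ _   pi = trans (inside pi) (-[x+y]+x≈0 (rowSum-W₁→W₂ pi))
        vanish W₂ W₂ _   pi = trans (inside pi) (-[x+y]+y≈0 (rowSum-W₂→W₁ pi))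
        vanish W₁ W₂ _   pi = outside pi (λ ()) (rowSum-W₂→W₁ pi)
        vanish W₂ W₁ _   pi = outside pi (λ ()) (rowSum-W₁→W₂ pi)

      X : Matrix ℝ n
      X = outerSym (𝟙 W₁) (𝟙 W₂)

      𝟙W₁*𝟙W₂≈0 : ∀ i j → (part i ≡ W₁ → part j ≡ W₂ → ⊥) → 𝟙 W₁ i * 𝟙 W₂ j ≈ 0#
      𝟙W₁*𝟙W₂≈0 i j ¬W₁W₂ with part i ≟ᴾ W₁ | part j ≟ᴾ W₂
      ... | no _    | _       = zeroˡ _
      ... | yes _   | no _    = zeroʳ _
      ... | yes piW | yes pjW = contradiction pjW (¬W₁W₂ piW)

      X≈0 : ∀ {i j} → (part i ≡ W₁ → part j ≡ W₂ → ⊥) → (part j ≡ W₁ → part i ≡ W₂ → ⊥) → X i j ≈ 0#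
      X≈0 {i} {j} ¬ij ¬ji = trans (+-cong (𝟙W₁*𝟙W₂≈0 i j ¬ij) (trans (*-comm _ _) (𝟙W₁*𝟙W₂≈0 j i ¬ji))) (+-identityˡ 0#)

      X-diag : ∀ i → X i i ≈ 0#
      X-diag i = X≈0 W₁≢W₂ W₁≢W₂
        where
        W₁≢W₂ : part i ≡ W₁ → part i ≡ W₂ → ⊥
        W₁≢W₂ piW₁ piW₂ with ≡.trans (≡.sym piW₁) piW₂
        ... | ()

      X-edge : ∀ {i j} → Edge G i j → X i j ≈ 0#
      X-edge {i} {j} ij = X≈0 (λ pi pj → no-W₁W₂-edge i j pi pj ij) (λ pj pi → no-W₁W₂-edge j i pj pi (edge-sym G ij))

      A∘X≈0 : IsZeroM ℝ (_∘ₕ_ ℝ A X)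
      A∘X≈0 i j with i ≟ j
      ... | yes ≡.refl = trans (*-congˡ (X-diag i)) (zeroʳ _)
      ... | no _ with adj G i j in ij
      ...   | false = zeroˡ _
      ...   | true  = trans (*-congˡ (X-edge ij)) (zeroʳ _)

      I∘X≈0 : IsZeroM ℝ (_∘ₕ_ ℝ (idM ℝ) X)
      I∘X≈0 i j with i ≟ j
      ... | yes ≡.refl = trans (*-congˡ (X-diag i)) (zeroʳ _)
      ... | no _       = zeroˡ _

      X≉0 : ¬ IsZeroM ℝ X
      X≉0 X≈0 with W₁-nonempty | W₂-nonempty
      ... | a , pa | b , pb = 0≉1 (begin
        0#                                      ≈⟨ X≈0 a b ⟨
        𝟙 W₁ a * 𝟙 W₂ b + 𝟙 W₂ a * 𝟙 W₁ b       ≈⟨ +-cong (*-cong (𝟙-≡ pa) (𝟙-≡ pb)) (*-congˡ (𝟙-≢ λ pb′ → W₂≢W₁ (≡.trans (≡.sym pb) pb′))) ⟩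
        1# * 1# + 𝟙 W₂ a * 0#                   ≈⟨ +-cong (*-identityˡ 1#) (zeroʳ _) ⟩
        1# + 0#                                 ≈⟨ +-identityʳ 1# ⟩
        1#                                      ∎)
        where
        W₂≢W₁ : W₂ ≢ W₁
        W₂≢W₁ ()

    barbell⇒¬GSSP : ∀ {n} (G : Graph n) → BarbellPartition G → ¬ InGSSP ℝ G
    barbell⇒¬GSSP G B G∈GSSP =
      annihilates⇒¬SSP A-symmetric (A-annihilates W₁ λ ()) (A-annihilates W₂ λ ()) A∘X≈0 I∘X≈0 X≉0 (G∈GSSP A A∈S)
      where open BarbellMatrix G B

open BarbellPartitions using (cactus⇒barbellPartition)
open StrongSpectralProperty using (barbell⇒¬GSSP)

mainTheorem2 : (ℝ : RealField) (n : ℕ) (G : Graph n) →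
    IsCactus G → AtLeastTwoCycles G →
    BarbellPartition G × ¬ InGSSP ℝ G
mainTheorem2 ℝ n G cactus twoCycles = barbell , barbell⇒¬GSSP ℝ G barbell
  where
  barbell : BarbellPartition G
  barbell = cactus⇒barbellPartition G cactus twoCycles
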